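{- For every $\Delta\geq 0$ (and every $m\ge1$), with probability $1$ over the random restriction $\rho^{(\Delta)}$ defined in the context, $\mathrm{relrk}_{(\tilde{Y},\tilde{Z})}\big(P^{(\Delta)}|_{\rho^{(\Delta)}}\big) = 1$, where $\tilde{Y}=\mathrm{Img}(\rho^{(\Delta)})\cap Y^{(\Delta)}$ and $\tilde{Z}=\mathrm{Img}(\rho^{(\Delta)})\cap Z^{(\Delta)}$.
   Context: Relative rank: for disjoint variable sets $Y,Z$ and a multilinear $g\in\mathbb{F}[Y\cup Z]$, $M_{(Y,Z)}(g)$ is the $2^{|Y|}\times2^{|Z|}$ matrix with rows indexed by multilinear monomials $m_1$ in $Y$, columns by multilinear monomials $m_2$ in $Z$, and $(m_1,m_2)$ entry the coefficient of $m_1m_2$ in $g$; $\mathrm{relrk}_{(Y,Z)}(g)=\mathrm{rank}(M_{(Y,Z)}(g))/2^{(|Y|+|Z|)/2}$. An $(X,Y,Z)$-restriction is a map $\rho:X\to Y\cup Z\cup\{0,1\}$; $f|_\rho$ is obtained by substitution. ABPs and compositions: an ABP is a DAG with source and sink, edges labelled by variables, computing the sum over source-sink paths of products of labels; parallel composition identifies all sources and all sinks, series composition identifies the sink of each with the source of the next. Graph and variables: $G^{(0)}$ has vertices $s_0,u_0,t_0$, two disjoint length-2 paths $\pi_1,\pi_2$ from $s_0$ to $u_0$ and two disjoint length-2 paths $\pi_3,\pi_4$ from $u_0$ to $t_0$, the edges of $\pi_i$ labelled in order by $x_{i,1},x_{i,2}$; $X^{(0)}=\{x_{i,j}:i\in[4],j\in[2]\}$,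 $Y^{(0)}=\{y_1,y_2\}$, $Z^{(0)}=\{z_1,z_2\}$. For $\Delta\geq0$ and $i\in[m],j\in[2]$ let $X^{(\Delta+1)}_{i,j},Y^{(\Delta+1)}_{i,j},Z^{(\Delta+1)}_{i,j}$ be pairwise disjoint copies of $X^{(\Delta)},Y^{(\Delta)},Z^{(\Delta)}$, and let $G^{(\Delta+1)}_{i,j}$ be the copy of $G^{(\Delta)}$ on $X^{(\Delta+1)}_{i,j}$; $H_i$ is the parallel composition of $G^{(\Delta+1)}_{i,1},G^{(\Delta+1)}_{i,2}$ and $G^{(\Delta+1)}$ is the series composition of $H_1,\dots,H_m$. Set $X^{(\Delta+1)}_i=X^{(\Delta+1)}_{i,1}\cup X^{(\Delta+1)}_{i,2}$, $X^{(\Delta+1)}=\bigcup_i X^{(\Delta+1)}_i$, $Y^{(\Delta+1)}=\bigcup_i(Y^{(\Delta+1)}_{i,1}\cup Y^{(\Delta+1)}_{i,2}\cup\{y^{(\Delta+1)}_i\})$, $Z^{(\Delta+1)}=\bigcup_i(Z^{(\Delta+1)}_{i,1}\cup Z^{(\Delta+1)}_{i,2}\cup\{z^{(\Delta+1)}_i\})$ with fresh variables $y^{(\Delta+1)}_i,z^{(\Delta+1)}_i$. $P^{(\Delta)}$ is the polynomial computed by $G^{(\Delta)}$. Restrictions: $\rho^{(0)}$ is deterministic: $x_{1,1}\mapsto y_1$, $x_{2,1}\mapsto z_1$, $x_{3,1}\mapsto y_2$, $x_{4,1}\mapsto z_2$, and $x_{i,2}\mapsto 1$ for all $i\in[4]$.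 $\rho^{(\Delta+1)}$ is the composition (union of maps) of independent restrictions $\rho_i$ on $X^{(\Delta+1)}_i$, $i\in[m]$, each sampled as follows, choosing one of three options uniformly at random (each with probability $1/3$): $E_1$: set all of $X^{(\Delta+1)}_{i,2}$ to $0$ and apply an independent copy of $\rho^{(\Delta)}$ to $X^{(\Delta+1)}_{i,1}$ (with images in $Y^{(\Delta+1)}_{i,1}\cup Z^{(\Delta+1)}_{i,1}\cup\{0,1\}$); $E_2$: the same with the roles of $j=1$ and $j=2$ exchanged; $E_3$: choose independently and uniformly $x_1\in X^{(\Delta+1)}_{i,1}$, $x_2\in X^{(\Delta+1)}_{i,2}$; for $j\in[2]$ let $\pi_{e_j}$ be the lexicographically smallest source-to-sink path of $G^{(\Delta+1)}_{i,j}$ containing the edge labelled $x_j$; set $x_1\mapsto y^{(\Delta+1)}_i$, $x_2\mapsto z^{(\Delta+1)}_i$, every other variable labelling an edge of $\pi_{e_1}$ or $\pi_{e_2}$ to $1$, and every remaining variable of $X^{(\Delta+1)}_i$ to $0$. -}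

module Defs where

open import Level using (Level; _⊔_)
open import Data.Nat using (ℕ; zero; suc; _≡ᵇ_)
open import Data.Fin using (Fin; zero; suc) renaming (_≟_ to _≟F_)
open import Data.Bool using (Bool; true; false; if_then_else_; _∧_)
open import Data.Unit using (⊤; tt)
open import Data.Unit.Properties renaming (_≟_ to _≟⊤_)
open import Data.Product using (Σ; _×_; _,_; proj₁; proj₂)
import Data.Product.Properties as ×P
open import Data.Sum using (_⊎_; inj₁; inj₂)
import Data.Sum.Properties as ⊎P
open import Data.Maybe using (Maybe; just; nothing)
open import Data.List using (List; []; _∷_; _++_; map; length; allFin;
  cartesianProduct; cartesianProductWith; concatMap; foldr; filterᵇ)
open import Data.Bool.ListAction using (any; all)
open import Data.Vec using (Vec; []; _∷_)
open import Relation.Nullary using (¬_; does)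
open import Relation.Binary using (DecidableEquality)
open import Relation.Binary.PropositionalEquality using (_≡_)
open import Algebra.Bundles using (CommutativeRing)

record Field (c ℓ : Level) : Set (Level.suc (c ⊔ ℓ)) where
  field
    commRing : CommutativeRing c ℓ
  open CommutativeRing commRing public
  field
    0≉1     : ¬ (0# ≈ 1#)
    inverse : ∀ x → ¬ (x ≈ 0#) → Σ Carrier (λ y → (x * y) ≈ 1#)

module LinAlg {c ℓ} (F : Field c ℓ) where
  open Field F using (Carrier; _≈_; _+_; _*_; 0#; 1#)

  sumFin : ∀ k → (Fin k → Carrier) → Carrier
  sumFin zero    f = 0#
  sumFin (suc k) f = f zero + sumFin k (λ i → f (suc i))

  sumList : List Carrier → Carrier
  sumList = foldr _+_ 0#

  Independent : {R C : Set} → (R → C → Carrier) → ∀ k → (Fin k → R) → Set (c ⊔ ℓ)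
  Independent {C = C} M k r =
    (coef : Fin k → Carrier) →
    (∀ (col : C) → sumFin k (λ l → coef l * M (r l) col) ≈ 0#) →
    ∀ l → coef l ≈ 0#

  HasRank : {R C : Set} → (R → C → Carrier) → ℕ → Set (c ⊔ ℓ)
  HasRank {R} M n =
    Σ (Fin n → R) (λ r → Independent M n r) ×
    (∀ (r : Fin (suc n) → R) → ¬ Independent M (suc n) r)

-- Variables.  m is the fan-out parameter of the construction.
--   XV m Δ : the variables X^(Δ)
--     X^(0)   : x_{a,k}  ↦  (a-1 , k-1) : Fin 4 × Fin 2
--     X^(Δ+1) : the copy of x ∈ X^(Δ) in X^(Δ+1)_{i,j}  ↦  (i-1 , j-1 , x)
--   YV m Δ : the variables Y^(Δ)
--     Y^(0)   : y_k ↦ k-1 : Fin 2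
--     Y^(Δ+1) : copy of y ∈ Y^(Δ) in Y^(Δ+1)_{i,j} ↦ (i-1 , inj₁ (j-1 , y));
--               fresh y^(Δ+1)_i ↦ (i-1 , inj₂ tt)
--   ZV m Δ : likewise for Z^(Δ).

XV : ℕ → ℕ → Set
XV m zero    = Fin 4 × Fin 2
XV m (suc Δ) = Fin m × (Fin 2 × XV m Δ)

YV : ℕ → ℕ → Set
YV m zero    = Fin 2
YV m (suc Δ) = Fin m × ((Fin 2 × YV m Δ) ⊎ ⊤)

ZV : ℕ → ℕ → Set
ZV = YV   -- same shape; Y and Z variables are kept apart by the tags below

_≟X_ : ∀ {m Δ} → DecidableEquality (XV m Δ)
_≟X_ {m} {zero}  = ×P.≡-dec _≟F_ _≟F_
_≟X_ {m} {suc Δ} = ×P.≡-dec _≟F_ (×P.≡-dec _≟F_ (_≟X_ {m} {Δ}))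

_≟Y_ : ∀ {m Δ} → DecidableEquality (YV m Δ)
_≟Y_ {m} {zero}  = _≟F_
_≟Y_ {m} {suc Δ} = ×P.≡-dec _≟F_ (⊎P.≡-dec (×P.≡-dec _≟F_ (_≟Y_ {m} {Δ})) _≟⊤_)

V : ℕ → ℕ → Set
V m Δ = YV m Δ ⊎ ZV m Δ

_≟V_ : ∀ {m Δ} → DecidableEquality (V m Δ)
_≟V_ {m} {Δ} = ⊎P.≡-dec (_≟Y_ {m} {Δ}) (_≟Y_ {m} {Δ})

allX : ∀ m Δ → List (XV m Δ)
allX m zero    = cartesianProduct (allFin 4) (allFin 2)
allX m (suc Δ) = cartesianProduct (allFin m) (cartesianProduct (allFin 2) (allX m Δ))

allY : ∀ m Δ → List (YV m Δ)
allY m zero    = allFin 2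
allY m (suc Δ) =
  cartesianProduct (allFin m)
    (map inj₁ (cartesianProduct (allFin 2) (allY m Δ)) ++ (inj₂ tt ∷ []))

allZ : ∀ m Δ → List (ZV m Δ)
allZ = allY

allV : ∀ m Δ → List (V m Δ)
allV m Δ = map inj₁ (allY m Δ) ++ map inj₂ (allZ m Δ)

-- The ABP G^(Δ) and its polynomial P^(Δ), given as the list (with
-- multiplicity) of the monomials (label sequences) of its source–sink
-- paths: P^(Δ) = Σ_{paths π} Π_{e ∈ π} label(e).

-- label sequences of the paths π_1,…,π_4 of G^(0)
piLab : Fin 4 → List (Fin 4 × Fin 2)
piLab a = (a , zero) ∷ (a , suc zero) ∷ []

emb : ∀ {m Δ} → Fin m → Fin 2 → List (XV m Δ) → List (XV m (suc Δ))
emb i j = map (λ x → (i , (j , x)))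

-- series composition: paths are concatenations of one path per block
seriesMons : ∀ {A : Set} → List (List (List A)) → List (List A)
seriesMons = foldr (cartesianProductWith _++_) ([] ∷ [])

-- G^(0): s₀ → u₀ via π_1 or π_2, then u₀ → t₀ via π_3 or π_4
-- G^(Δ+1): series composition of H_1..H_m, H_i = parallel composition
--          of G^(Δ+1)_{i,1}, G^(Δ+1)_{i,2}
pathMons : ∀ m Δ → List (List (XV m Δ))
pathMons m zero =
  cartesianProductWith _++_
    (piLab zero ∷ piLab (suc zero) ∷ [])
    (piLab (suc (suc zero)) ∷ piLab (suc (suc (suc zero))) ∷ [])
pathMons m (suc Δ) =
  seriesMons (map (λ i → map (emb i zero) (pathMons m Δ) ++
                         map (emb i (suc zero)) (pathMons m Δ)) (allFin m))

-- Lexicographically smallest source–sink path (label sequence), where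
-- at every branching the lower-indexed branch is smaller (π_1 < π_2,
-- π_3 < π_4, and in H_i the copy j=1 before j=2).
minPath : ∀ m Δ → List (XV m Δ)
minPath m zero    = piLab zero ++ piLab (suc (suc zero))
minPath m (suc Δ) = concatMap (λ i → emb i zero (minPath m Δ)) (allFin m)

-- lexicographically smallest source–sink path containing the edge labelled x
lexPath : ∀ m Δ → XV m Δ → List (XV m Δ)
lexPath m zero (zero , _)                   = piLab zero ++ piLab (suc (suc zero))
lexPath m zero (suc zero , _)               = piLab (suc zero) ++ piLab (suc (suc zero))
lexPath m zero (suc (suc zero) , _)         = piLab zero ++ piLab (suc (suc zero))
lexPath m zero (suc (suc (suc zero)) , _)   = piLab zero ++ piLab (suc (suc (suc zero)))
lexPath m (suc Δ) (i , (j , x)) =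
  concatMap (λ i' → if does (i' ≟F i) then emb i j (lexPath m Δ x)
                                       else emb i' zero (minPath m Δ))
            (allFin m)

-- Restrictions ρ : X → Y ∪ Z ∪ {0,1}

data Tgt (m Δ : ℕ) : Set where
  ty   : YV m Δ → Tgt m Δ
  tz   : ZV m Δ → Tgt m Δ
  zer  : Tgt m Δ
  one  : Tgt m Δ

-- the random choices of ρ^(Δ+1) in one block i
data Blk (C X : Set) : Set where
  E1 : C → Blk C X        -- X_{i,2} ↦ 0, ρ^(Δ) (with these choices) on X_{i,1}
  E2 : C → Blk C X        -- X_{i,1} ↦ 0, ρ^(Δ) (with these choices) on X_{i,2}
  E3 : X → X → Blk C X    -- x₁ ∈ X_{i,1}, x₂ ∈ X_{i,2} (as copies of X^(Δ))

-- all possible outcomes of the random choices made in sampling ρ^(Δ);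
-- each outcome has positive probability
Choice : ℕ → ℕ → Set
Choice m zero    = ⊤
Choice m (suc Δ) = Fin m → Blk (Choice m Δ) (XV m Δ)

liftT : ∀ {m Δ} → Fin m → Fin 2 → Tgt m Δ → Tgt m (suc Δ)
liftT i j (ty y) = ty (i , inj₁ (j , y))
liftT i j (tz z) = tz (i , inj₁ (j , z))
liftT i j zer    = zer
liftT i j one    = one

elemX : ∀ {m Δ} → XV m Δ → List (XV m Δ) → Bool
elemX x xs = any (λ x' → does (x ≟X x')) xs

rho0 : ∀ {m} → XV m zero → Tgt m zero
rho0 (zero , zero)                     = ty zero
rho0 (suc zero , zero)                 = tz zero
rho0 (suc (suc zero) , zero)           = ty (suc zero)
rho0 (suc (suc (suc zero)) , zero)     = tz (suc zero)
rho0 (_ , suc zero)                    = one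

rho : ∀ m Δ → Choice m Δ → XV m Δ → Tgt m Δ
rho m zero    _  x = rho0 x
rho m (suc Δ) ch (i , (zero , x)) with ch i
... | E1 c    = liftT i zero (rho m Δ c x)
... | E2 c    = zer
... | E3 x₁ x₂ =
  if does (x ≟X x₁) then ty (i , inj₂ tt)
  else if elemX x (lexPath m Δ x₁) then one else zer
rho m (suc Δ) ch (i , (suc zero , x)) with ch i
... | E1 c    = zer
... | E2 c    = liftT i (suc zero) (rho m Δ c x)
... | E3 x₁ x₂ =
  if does (x ≟X x₂) then tz (i , inj₂ tt)
  else if elemX x (lexPath m Δ x₂) then one else zer

-- Restricted polynomial P^(Δ)|_ρ : monomial of each path after substitution
-- (nothing = the monomial became 0; otherwise the list of remaining Y∪Z
-- variables, constants 1 dropped).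

restrictMon : ∀ {m Δ} → (XV m Δ → Tgt m Δ) → List (XV m Δ) → Maybe (List (V m Δ))
restrictMon ρ [] = just []
restrictMon ρ (x ∷ xs) with restrictMon ρ xs
... | nothing = nothing
... | just vs with ρ x
...   | ty y = just (inj₁ y ∷ vs)
...   | tz z = just (inj₂ z ∷ vs)
...   | zer  = nothing
...   | one  = just vs

expo : ∀ {m Δ} → V m Δ → List (V m Δ) → ℕ
expo v vs = length (filterᵇ (λ w → does (w ≟V v)) vs)

sameMon : ∀ m Δ → List (V m Δ) → List (V m Δ) → Bool
sameMon m Δ a b = all (λ v → expo v a ≡ᵇ expo v b) (allV m Δ)

isTy : ∀ {m Δ} → YV m Δ → Tgt m Δ → Bool
isTy y (ty y') = does (y ≟Y y')
isTy y _       = false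

isTz : ∀ {m Δ} → ZV m Δ → Tgt m Δ → Bool
isTz z (tz z') = does (z ≟Y z')
isTz z _       = false

Ytil : ∀ m Δ → Choice m Δ → List (YV m Δ)
Ytil m Δ ch = filterᵇ (λ y → any (λ x → isTy y (rho m Δ ch x)) (allX m Δ)) (allY m Δ)

Ztil : ∀ m Δ → Choice m Δ → List (ZV m Δ)
Ztil m Δ ch = filterᵇ (λ z → any (λ x → isTz z (rho m Δ ch x)) (allX m Δ)) (allZ m Δ)

-- multilinear monomial in the variables of a list, selected by a subset
select : ∀ {A : Set} (xs : List A) → Vec Bool (length xs) → List A
select []       []            = []
select (x ∷ xs) (true  ∷ bs)  = x ∷ select xs bs
select (x ∷ xs) (false ∷ bs)  = select xs bs

-- M_(Ỹ,Z̃)(P^(Δ)|_ρ): rows = multilinear monomials in Ỹ (subsets of Ỹ),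
-- columns = multilinear monomials in Z̃; entry = coefficient of m₁m₂.
relMatrix : ∀ {c ℓ} (F : Field c ℓ) m Δ (ch : Choice m Δ) →
            Vec Bool (length (Ytil m Δ ch)) → Vec Bool (length (Ztil m Δ ch)) →
            Field.Carrier F
relMatrix F m Δ ch S T =
  LinAlg.sumList F (map coeffOf (pathMons m Δ))
  where
  open Field F using (Carrier; _≈_; _+_; _*_; 0#; 1#)
  target : List (V m Δ)
  target = map inj₁ (select (Ytil m Δ ch) S) ++ map inj₂ (select (Ztil m Δ ch) T)
  coeffOf : List (XV m Δ) → Carrier
  coeffOf p with restrictMon (rho m Δ ch) p
  ... | nothing = 0#
  ... | just vs = if sameMon m Δ vs target then 1# else 0#

module Submission where

-- The coefficient of a monomial x^w in P^(Δ)|ρ is the number of source–sink paths whose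
-- restricted label product is x^w.  G^(Δ+1) is a series composition of blocks with disjoint
-- variables, so this count is the product of the block counts.  A block with choice E1 or E2
-- is a single copy of G^(Δ), so induction applies; a block with choice E3 keeps exactly two
-- paths, the lexicographically smallest ones through the two chosen edges, because such a
-- path is the only path of G^(Δ) on its own edges; they contribute y_i + z_i.  Hence
-- P^(Δ)|ρ = ∏_{k ∈ Ỹ} (y_k + z_k) with Ỹ = Z̃ as index sets.  In the coefficient matrix of this
-- product the row of S ⊆ Ỹ has a single nonzero entry, in the column of the complement of S,
-- so the matrix has full rank 2^|Ỹ| = (2^(|Ỹ|+|Z̃|))^(1/2).

open import Defs
open import Data.Nat using (ℕ; zero; suc; _+_; _*_; _^_; _≤_; z≤n; s≤s; _≡ᵇ_)
open import Data.Nat.Properties using (n<1+n; ≡ᵇ⇒≡; ≡⇒≡ᵇ; ^-distribˡ-+-*)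
import Data.Nat.Properties as ℕₚ
open import Data.Nat.ListAction using (product)
open import Data.Bool using (Bool; true; false; if_then_else_; _∧_; _∨_; not; T)
open import Data.Bool.ListAction using (all; any)
open import Data.Bool.Properties using (∧-zeroʳ; ∧-identityʳ; ∨-identityʳ)
open import Data.Fin using (Fin; zero; suc) renaming (_≟_ to _≟F_)
open import Data.Fin.Properties using (*↔×; 2↔Bool; suc-injective; pigeonhole; <⇒≢)
open import Data.Vec using (Vec; []; _∷_)
import Data.Vec
open import Data.List using (List; []; _∷_; _++_; map; length; filterᵇ; cartesianProductWith;
  cartesianProduct; allFin; concat; concatMap; replicate)
open import Data.List.Properties using (length-++; length-map; filter-++; map-cong)
open import Data.List.Relation.Unary.All as All using (All; []; _∷_)
open import Data.List.Relation.Unary.All.Properties using (++⁺; map⁺; cartesianProductWith⁺)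
open import Data.List.Relation.Unary.Any using (here; there)
open import Data.List.Membership.Propositional using (_∈_; _∉_)
open import Data.List.Membership.Propositional.Properties
  using (∈-allFin; ∈-cartesianProduct⁺; ∈-map⁺; ∈-map⁻; ∈-++⁺ˡ; ∈-++⁺ʳ; ∈-filter⁺; ∈-filter⁻)
open import Data.List.Relation.Unary.Unique.Propositional using (Unique)
import Data.List.Relation.Unary.Unique.Propositional.Properties as Unique
open import Data.List.Relation.Unary.AllPairs using ([]; _∷_)
open import Data.List.Relation.Binary.Disjoint.Propositional using (Disjoint)
open import Data.Maybe using (Maybe; just; nothing; zipWith) renaming (map to mapᴹ)
open import Data.Product using (Σ; ∃; _×_; _,_; proj₁; proj₂; uncurry)
open import Data.Product.Function.NonDependent.Propositional using (_×-↔_)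
open import Data.Sum using (_⊎_; inj₁; inj₂)
open import Data.Sum.Properties using (inj₁-injective)
open import Data.Unit using (⊤; tt)
open import Data.Empty using (⊥-elim)
open import Function using (_∘_)
open import Function.Definitions using (Injective)
open import Function.Bundles using (_↔_; Inverse; mk↔ₛ′)
open import Function.Properties.Inverse using (↔-trans)
open import Relation.Binary using (DecidableEquality)
open import Relation.Nullary using (¬_; Dec; yes; no; does)
open import Relation.Nullary.Decidable using (dec-true; dec-false; T?)
open import Relation.Binary.PropositionalEquality

countᵇ : {A : Set} → (A → Bool) → List A → ℕ
countᵇ p xs = length (filterᵇ p xs)

bit : Bool → ℕ
bit b = if b then 1 else 0

module _ {A : Set} where

  filterᵇ-cong : {p q : A → Bool} {xs : List A} →
    All (λ x → p x ≡ q x) xs → filterᵇ p xs ≡ filterᵇ q xs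
  filterᵇ-cong {q = q} {x ∷ xs} (e ∷ es) rewrite e with q x
  ... | true  = cong (x ∷_) (filterᵇ-cong es)
  ... | false = filterᵇ-cong es
  filterᵇ-cong {xs = []} [] = refl

  filterᵇ-∷ : (p : A → Bool) (x : A) (xs : List A) →
    filterᵇ p (x ∷ xs) ≡ (if p x then x ∷ filterᵇ p xs else filterᵇ p xs)
  filterᵇ-∷ p x xs with p x
  ... | true  = refl
  ... | false = refl

  filterᵇ-none : {p : A → Bool} {xs : List A} → All (λ x → p x ≡ false) xs → filterᵇ p xs ≡ []
  filterᵇ-none [] = refl
  filterᵇ-none (e ∷ es) rewrite e = filterᵇ-none es

  filterᵇ-weaken : (p q : A → Bool) (xs : List A) → (∀ x → p x ≡ true → q x ≡ true) →
    filterᵇ p xs ≡ filterᵇ p (filterᵇ q xs)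
  filterᵇ-weaken p q [] p⇒q = refl
  filterᵇ-weaken p q (x ∷ xs) p⇒q with p x in px | q x in qx
  ... | true  | true  rewrite px = cong (x ∷_) (filterᵇ-weaken p q xs p⇒q)
  ... | true  | false with () ← trans (sym (p⇒q x px)) qx
  ... | false | true  rewrite px = filterᵇ-weaken p q xs p⇒q
  ... | false | false = filterᵇ-weaken p q xs p⇒q

  countᵇ-∷ : (p : A → Bool) (x : A) (xs : List A) → countᵇ p (x ∷ xs) ≡ bit (p x) + countᵇ p xs
  countᵇ-∷ p x xs with p x
  ... | true  = refl
  ... | false = refl

  countᵇ-++ : (p : A → Bool) (xs ys : List A) → countᵇ p (xs ++ ys) ≡ countᵇ p xs + countᵇ p ys
  countᵇ-++ p xs ys = trans (cong length (filter-++ (T? ∘ p) xs ys)) (length-++ (filterᵇ p xs))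

  countᵇ-witness : (p : A → Bool) (xs : List A) → ¬ countᵇ p xs ≡ 0 → ∃ λ x → p x ≡ true
  countᵇ-witness p [] n = ⊥-elim (n refl)
  countᵇ-witness p (x ∷ xs) n with p x in px
  ... | true  = x , px
  ... | false = countᵇ-witness p xs n

module _ {A B : Set} where

  filterᵇ-map : (p : B → Bool) (f : A → B) (xs : List A) →
    filterᵇ p (map f xs) ≡ map f (filterᵇ (p ∘ f) xs)
  filterᵇ-map p f [] = refl
  filterᵇ-map p f (x ∷ xs) with p (f x)
  ... | true  = cong (f x ∷_) (filterᵇ-map p f xs)
  ... | false = filterᵇ-map p f xs

  countᵇ-map : (p : B → Bool) (f : A → B) (xs : List A) → countᵇ p (map f xs) ≡ countᵇ (p ∘ f) xs
  countᵇ-map p f xs = trans (cong length (filterᵇ-map p f xs)) (length-map f (filterᵇ (p ∘ f) xs))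

module _ {A B C : Set} (f : A → B → C) where

  filterᵇ-cartesianProductWith : (p : C → Bool) (pa : A → Bool) (pb : B → Bool) (as : List A) (bs : List B) →
    (∀ {a b} → a ∈ as → b ∈ bs → p (f a b) ≡ pa a ∧ pb b) →
    filterᵇ p (cartesianProductWith f as bs) ≡ cartesianProductWith f (filterᵇ pa as) (filterᵇ pb bs)
  filterᵇ-cartesianProductWith p pa pb [] bs h = refl
  filterᵇ-cartesianProductWith p pa pb (a ∷ as) bs h = begin
    filterᵇ p (map (f a) bs ++ cartesianProductWith f as bs)
      ≡⟨ filter-++ (T? ∘ p) (map (f a) bs) _ ⟩
    filterᵇ p (map (f a) bs) ++ filterᵇ p (cartesianProductWith f as bs)
      ≡⟨ cong₂ _++_ (trans (filterᵇ-map p (f a) bs) (cong (map (f a)) (filterᵇ-cong (All.tabulate (h (here refl))))))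
                    (filterᵇ-cartesianProductWith p pa pb as bs (h ∘ there)) ⟩
    map (f a) (filterᵇ (λ b → pa a ∧ pb b) bs) ++ cartesianProductWith f (filterᵇ pa as) (filterᵇ pb bs)
      ≡⟨ step (pa a) ⟩
    cartesianProductWith f (if pa a then a ∷ filterᵇ pa as else filterᵇ pa as) (filterᵇ pb bs)
      ≡⟨ cong (λ l → cartesianProductWith f l (filterᵇ pb bs)) (filterᵇ-∷ pa a as) ⟨
    cartesianProductWith f (filterᵇ pa (a ∷ as)) (filterᵇ pb bs) ∎
    where
    open ≡-Reasoning
    step : (c : Bool) → map (f a) (filterᵇ (λ b → c ∧ pb b) bs) ++ cartesianProductWith f (filterᵇ pa as) (filterᵇ pb bs)
                      ≡ cartesianProductWith f (if c then a ∷ filterᵇ pa as else filterᵇ pa as) (filterᵇ pb bs)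
    step true  = refl
    step false = cong (_++ _) (cong (map (f a)) (filterᵇ-none (All.universal (λ _ → refl) bs)))

  length-cartesianProductWith : (as : List A) (bs : List B) →
    length (cartesianProductWith f as bs) ≡ length as * length bs
  length-cartesianProductWith [] bs = refl
  length-cartesianProductWith (a ∷ as) bs = begin
    length (map (f a) bs ++ cartesianProductWith f as bs)  ≡⟨ length-++ (map (f a) bs) ⟩
    length (map (f a) bs) + length (cartesianProductWith f as bs)
      ≡⟨ cong₂ _+_ (length-map (f a) bs) (length-cartesianProductWith as bs) ⟩
    length bs + length as * length bs ∎
    where open ≡-Reasoning

  countᵇ-cartesianProductWith : (p : C → Bool) (pa : A → Bool) (pb : B → Bool) (as : List A) (bs : List B) →
    (∀ {a b} → a ∈ as → b ∈ bs → p (f a b) ≡ pa a ∧ pb b) →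
    countᵇ p (cartesianProductWith f as bs) ≡ countᵇ pa as * countᵇ pb bs
  countᵇ-cartesianProductWith p pa pb as bs h =
    trans (cong length (filterᵇ-cartesianProductWith p pa pb as bs h))
          (length-cartesianProductWith (filterᵇ pa as) (filterᵇ pb bs))

countᵇ-single : {A : Set} (p : A → Bool) (x : A) → countᵇ p (x ∷ []) ≡ bit (p x)
countᵇ-single p x = trans (countᵇ-∷ p x []) (ℕₚ.+-identityʳ _)

countᵇ-pair : {A : Set} (p : A → Bool) (x y : A) → countᵇ p (x ∷ y ∷ []) ≡ bit (p x) + bit (p y)
countᵇ-pair p x y = trans (countᵇ-∷ p x (y ∷ [])) (cong (bit (p x) +_) (countᵇ-single p y))

module _ {A B : Set} (p : A → Bool) where

  countᵇ-concatMap : (f : B → List A) (q : B → Bool) → (∀ b → countᵇ p (f b) ≡ bit (q b)) →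
    ∀ bs → countᵇ p (concatMap f bs) ≡ countᵇ q bs
  countᵇ-concatMap f q h []       = refl
  countᵇ-concatMap f q h (b ∷ bs) with q b | h b
  ... | true  | pfb≡1 = trans (countᵇ-++ p (f b) (concatMap f bs)) (cong₂ _+_ pfb≡1 (countᵇ-concatMap f q h bs))
  ... | false | pfb≡0 = trans (countᵇ-++ p (f b) (concatMap f bs)) (cong₂ _+_ pfb≡0 (countᵇ-concatMap f q h bs))

countᵇ-≟-unique : {A : Set} (_≟_ : DecidableEquality A) {x : A} {xs : List A} → Unique xs → x ∈ xs →
  countᵇ (λ y → does (y ≟ x)) xs ≡ 1
countᵇ-≟-unique _≟_ {x} (x∉xs ∷ _) (here refl) rewrite dec-true (x ≟ x) refl =
  cong suc (countᵇ-none (All.map (λ x≢y → dec-false (_ ≟ x) (x≢y ∘ sym)) x∉xs))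
  where
  countᵇ-none : ∀ {xs} → All (λ y → does (y ≟ x) ≡ false) xs → countᵇ (λ y → does (y ≟ x)) xs ≡ 0
  countᵇ-none none = cong length (filterᵇ-none none)
countᵇ-≟-unique _≟_ {x} (_∷_ {y} y∉xs unique) (there x∈xs) with y ≟ x
... | yes refl = ⊥-elim (All.lookup y∉xs x∈xs refl)
... | no _     = countᵇ-≟-unique _≟_ unique x∈xs

∧-elimˡ : ∀ {b c} → b ∧ c ≡ true → b ≡ true
∧-elimˡ {true} _ = refl

∧-elimʳ : ∀ {b c} → b ∧ c ≡ true → c ≡ true
∧-elimʳ {true} e = e

∧-intro : ∀ {b c} → b ≡ true → c ≡ true → b ∧ c ≡ true
∧-intro refl refl = refl

∨-introʳ : ∀ b {c} → c ≡ true → b ∨ c ≡ true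
∨-introʳ true  _ = refl
∨-introʳ false e = e

∨-elim : ∀ {b c} → b ∨ c ≡ true → b ≡ true ⊎ c ≡ true
∨-elim {true}  _ = inj₁ refl
∨-elim {false} e = inj₂ e

Bool-≡ : ∀ {b c : Bool} → (b ≡ true → c ≡ true) → (c ≡ true → b ≡ true) → b ≡ c
Bool-≡ {true}  {true}  f g = refl
Bool-≡ {true}  {false} f g = sym (f refl)
Bool-≡ {false} {true}  f g = g refl
Bool-≡ {false} {false} f g = refl

T⇒≡true : ∀ {b} → T b → b ≡ true
T⇒≡true {true} _ = refl

≡true⇒T : ∀ {b} → b ≡ true → T b
≡true⇒T refl = tt

does-sound : ∀ {P : Set} (d : Dec P) → does d ≡ true → P
does-sound (yes p) _ = p

module _ {A : Set} where

  all-sound : (p : A → Bool) {xs : List A} → all p xs ≡ true → ∀ {x} → x ∈ xs → p x ≡ true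
  all-sound p e (here refl) = ∧-elimˡ e
  all-sound p {y ∷ _} e (there x∈) = all-sound p (∧-elimʳ {p y} e) x∈

  all-complete : (p : A → Bool) (xs : List A) → (∀ {x} → x ∈ xs → p x ≡ true) → all p xs ≡ true
  all-complete p [] h = refl
  all-complete p (x ∷ xs) h = ∧-intro (h (here refl)) (all-complete p xs (h ∘ there))

  any-sound : (p : A → Bool) (xs : List A) → any p xs ≡ true → ∃ λ x → p x ≡ true
  any-sound p (x ∷ xs) e with ∨-elim {p x} e
  ... | inj₁ px = x , px
  ... | inj₂ rest = any-sound p xs rest

  any-complete : (p : A → Bool) {xs : List A} {x : A} → x ∈ xs → p x ≡ true → any p xs ≡ true
  any-complete p (here refl) e rewrite e = refl
  any-complete p {y ∷ _} (there x∈) e = ∨-introʳ (p y) (any-complete p x∈ e)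

  any-none : (p : A → Bool) {xs : List A} → All (λ x → p x ≡ false) xs → any p xs ≡ false
  any-none p [] = refl
  any-none p (e ∷ es) rewrite e = any-none p es

  any-++ : (p : A → Bool) (xs ys : List A) → any p (xs ++ ys) ≡ any p xs ∨ any p ys
  any-++ p [] ys = refl
  any-++ p (x ∷ xs) ys with p x
  ... | true  = refl
  ... | false = any-++ p xs ys

  all-++ : (p : A → Bool) (xs ys : List A) → all p (xs ++ ys) ≡ all p xs ∧ all p ys
  all-++ p [] ys = refl
  all-++ p (x ∷ xs) ys with p x
  ... | true  = all-++ p xs ys
  ... | false = refl

all-cong : {A : Set} {p q : A → Bool} {xs : List A} → All (λ x → p x ≡ q x) xs → all p xs ≡ all q xs
all-cong [] = refl
all-cong (e ∷ es) = cong₂ _∧_ e (all-cong es)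

∧-interleave : ∀ a b c d → a ∧ (b ∧ (c ∧ (d ∧ true))) ≡ (a ∧ c) ∧ (b ∧ d)
∧-interleave false b c d = refl
∧-interleave true  false c d = sym (∧-zeroʳ c)
∧-interleave true  true  c d = cong (c ∧_) (∧-identityʳ d)

does-injective : {A B : Set} (_≟A_ : DecidableEquality A) (_≟B_ : DecidableEquality B)
  {f : A → B} → Injective _≡_ _≡_ f → ∀ a b → does (f a ≟B f b) ≡ does (a ≟A b)
does-injective _≟A_ _≟B_ {f} f-inj a b with a ≟A b
... | yes refl = dec-true (f a ≟B f a) refl
... | no a≢b   = dec-false (f a ≟B f b) (a≢b ∘ f-inj)

Indicator : ℕ → Set → Set
Indicator n P = (n ≡ 1 × P) ⊎ (n ≡ 0 × ¬ P)

module _ {n : ℕ} {P : Set} where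

  Indicator-⇒≡1 : Indicator n P → P → n ≡ 1
  Indicator-⇒≡1 (inj₁ (n≡1 , _)) _ = n≡1
  Indicator-⇒≡1 (inj₂ (_ , ¬p)) p = ⊥-elim (¬p p)

  Indicator-¬⇒≡0 : Indicator n P → ¬ P → n ≡ 0
  Indicator-¬⇒≡0 (inj₁ (_ , p)) ¬p = ⊥-elim (¬p p)
  Indicator-¬⇒≡0 (inj₂ (n≡0 , _)) _ = n≡0

  Indicator-resp : {n′ : ℕ} {Q : Set} → n ≡ n′ → (P → Q) → (Q → P) → Indicator n P → Indicator n′ Q
  Indicator-resp refl f g (inj₁ (n≡1 , p)) = inj₁ (n≡1 , f p)
  Indicator-resp refl f g (inj₂ (n≡0 , ¬p)) = inj₂ (n≡0 , ¬p ∘ g)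

Indicator-bit : (b : Bool) → Indicator (bit b) (b ≡ true)
Indicator-bit true  = inj₁ (refl , refl)
Indicator-bit false = inj₂ (refl , λ ())

Indicator-* : ∀ {m n P Q} → Indicator m P → Indicator n Q → Indicator (m * n) (P × Q)
Indicator-* (inj₁ (refl , p)) (inj₁ (refl , q)) = inj₁ (refl , p , q)
Indicator-* (inj₁ (refl , _)) (inj₂ (refl , ¬q)) = inj₂ (refl , ¬q ∘ proj₂)
Indicator-* (inj₂ (refl , ¬p)) _ = inj₂ (refl , ¬p ∘ proj₁)

Indicator-+ : ∀ {m n P Q} → Indicator m P → Indicator n Q → ¬ (P × Q) → Indicator (m + n) (P ⊎ Q)
Indicator-+ (inj₁ (refl , p)) (inj₁ (refl , q)) excl = ⊥-elim (excl (p , q))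
Indicator-+ (inj₁ (refl , p)) (inj₂ (refl , _)) _ = inj₁ (refl , inj₁ p)
Indicator-+ (inj₂ (refl , _)) (inj₁ (refl , q)) _ = inj₁ (refl , inj₂ q)
Indicator-+ (inj₂ (refl , ¬p)) (inj₂ (refl , ¬q)) _ = inj₂ (refl , λ { (inj₁ p) → ¬p p ; (inj₂ q) → ¬q q })

Indicator-product : {I : Set} {f : I → ℕ} {P : I → Set} → (∀ i → Indicator (f i) (P i)) →
  (is : List I) → Indicator (product (map f is)) (All P is)
Indicator-product ind [] = inj₁ (refl , [])
Indicator-product ind (i ∷ is) =
  Indicator-resp refl (λ (p , ps) → p ∷ ps) (λ { (p ∷ ps) → p , ps })
    (Indicator-* (ind i) (Indicator-product ind is))

+≡1⇒ : ∀ a b → a + b ≡ 1 → (a ≡ 1 × b ≡ 0) ⊎ (a ≡ 0 × b ≡ 1)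
+≡1⇒ zero       (suc zero) refl = inj₂ (refl , refl)
+≡1⇒ (suc zero) zero       refl = inj₁ (refl , refl)
+≡1⇒ zero       zero       ()
+≡1⇒ zero       (suc (suc b)) ()
+≡1⇒ (suc zero) (suc b)    ()
+≡1⇒ (suc (suc a)) b       ()

sum≡1-indicator : ∀ a c → Indicator (bit ((1 ≡ᵇ a) ∧ (0 ≡ᵇ c)) + bit ((0 ≡ᵇ a) ∧ (1 ≡ᵇ c))) (a + c ≡ 1)
sum≡1-indicator zero c =
  Indicator-resp refl (λ e → sym (≡ᵇ⇒≡ 1 c (≡true⇒T e))) (λ { refl → refl }) (Indicator-bit (1 ≡ᵇ c))
sum≡1-indicator (suc zero) c =
  Indicator-resp (sym (ℕₚ.+-identityʳ _)) (λ e → cong suc (sym (≡ᵇ⇒≡ 0 c (≡true⇒T e)))) (λ { refl → refl })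
    (Indicator-bit (0 ≡ᵇ c))
sum≡1-indicator (suc (suc a)) c = inj₂ (refl , λ ())

zipWith-++-just⁻ : {A : Set} (r s : Maybe (List A)) {vs : List A} → zipWith _++_ r s ≡ just vs →
  ∃ λ va → ∃ λ vb → r ≡ just va × s ≡ just vb × vs ≡ va ++ vb
zipWith-++-just⁻ (just a) (just b) refl = a , b , refl , refl , refl

mapᴹ-just⁻ : {A B : Set} (f : A → B) (r : Maybe A) {b : B} → mapᴹ f r ≡ just b → ∃ λ a → r ≡ just a × b ≡ f a
mapᴹ-just⁻ f (just a) refl = a , refl , refl

-- Rank and subsets

vecBool↔ : ∀ k → Fin (2 ^ k) ↔ Vec Bool k
vecBool↔ zero    = mk↔ₛ′ (λ _ → []) (λ _ → zero) (λ { [] → refl }) (λ { zero → refl })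
vecBool↔ (suc k) = ↔-trans *↔× (↔-trans (2↔Bool ×-↔ vecBool↔ k) cons↔)
  where
  cons↔ : (Bool × Vec Bool k) ↔ Vec Bool (suc k)
  cons↔ = mk↔ₛ′ (uncurry _∷_) (λ { (b ∷ v) → b , v }) (λ { (b ∷ v) → refl }) (λ { (b , v) → refl })

module Rank {c ℓ} (F : Field c ℓ) where
  open Field F renaming (_+_ to _+ᶠ_; _*_ to _*ᶠ_; setoid to ≈-setoid; refl to ≈-refl; sym to ≈-sym; trans to ≈-trans)
    hiding (zero)
  open LinAlg F
  open import Algebra.Properties.Ring ring using (-1*x≈-x)
  open import Relation.Binary.Reasoning.Setoid ≈-setoid

  sumFin-zero : ∀ n (f : Fin n → Carrier) → (∀ l → f l ≈ 0#) → sumFin n f ≈ 0#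
  sumFin-zero zero    f f≈0 = ≈-refl
  sumFin-zero (suc n) f f≈0 = ≈-trans (+-cong (f≈0 zero) (sumFin-zero n _ (f≈0 ∘ suc))) (+-identityˡ 0#)

  sumFin-one : ∀ n (f : Fin n → Carrier) i → (∀ l → ¬ l ≡ i → f l ≈ 0#) → sumFin n f ≈ f i
  sumFin-one (suc n) f zero    f≈0 = ≈-trans (+-cong ≈-refl (sumFin-zero n _ (λ l → f≈0 (suc l) (λ ())))) (+-identityʳ _)
  sumFin-one (suc n) f (suc i) f≈0 =
    ≈-trans (+-cong (f≈0 zero (λ ())) (sumFin-one n _ i (λ l l≢i → f≈0 (suc l) (l≢i ∘ suc-injective)))) (+-identityˡ _)

  sumFin-two : ∀ n (f : Fin n → Carrier) i j → ¬ i ≡ j → (∀ l → ¬ l ≡ i → ¬ l ≡ j → f l ≈ 0#) →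
    sumFin n f ≈ f i +ᶠ f j
  sumFin-two (suc n) f zero    zero    i≢j f≈0 = ⊥-elim (i≢j refl)
  sumFin-two (suc n) f zero    (suc j) i≢j f≈0 =
    +-cong ≈-refl (sumFin-one n _ j (λ l l≢j → f≈0 (suc l) (λ ()) (l≢j ∘ suc-injective)))
  sumFin-two (suc n) f (suc i) zero    i≢j f≈0 =
    ≈-trans (+-cong ≈-refl (sumFin-one n _ i (λ l l≢i → f≈0 (suc l) (l≢i ∘ suc-injective) (λ ())))) (+-comm _ _)
  sumFin-two (suc n) f (suc i) (suc j) i≢j f≈0 =
    ≈-trans (+-cong (f≈0 zero (λ ()) (λ ()))
                    (sumFin-two n _ i j (i≢j ∘ cong suc)
                                (λ l l≢i l≢j → f≈0 (suc l) (l≢i ∘ suc-injective) (l≢j ∘ suc-injective))))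
            (+-identityˡ _)

  -- M has an n × n identity submatrix.
  hasRank-unitColumns : ∀ {R C : Set} {n} (enum : Fin n ↔ R) (M : R → C → Carrier) (col : R → C) →
    (∀ r → M r (col r) ≈ 1#) → (∀ r′ r → ¬ r′ ≡ r → M r′ (col r) ≈ 0#) → HasRank M n
  hasRank-unitColumns {R} {C} {n} enum M col M≈1 M≈0 = (to , independent) , dependent
    where
    open Inverse enum using (to; from; strictlyInverseˡ; strictlyInverseʳ)
    to-injective : ∀ {a b} → to a ≡ to b → a ≡ b
    to-injective {a} {b} e = trans (sym (strictlyInverseʳ a)) (trans (cong from e) (strictlyInverseʳ b))
    from-injective : ∀ {a b} → from a ≡ from b → a ≡ b
    from-injective {a} {b} e = trans (sym (strictlyInverseˡ a)) (trans (cong to e) (strictlyInverseˡ b))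
    independent : Independent M n to
    independent coef combination≈0 l = begin
      coef l                                                ≈⟨ *-identityʳ _ ⟨
      coef l *ᶠ 1#                                          ≈⟨ *-cong ≈-refl (M≈1 (to l)) ⟨
      coef l *ᶠ M (to l) (col (to l))                       ≈⟨ sumFin-one n _ l offDiagonal ⟨
      sumFin n (λ l′ → coef l′ *ᶠ M (to l′) (col (to l)))   ≈⟨ combination≈0 (col (to l)) ⟩
      0#                                                    ∎
      where
      offDiagonal : ∀ l′ → ¬ l′ ≡ l → coef l′ *ᶠ M (to l′) (col (to l)) ≈ 0#
      offDiagonal l′ l′≢l = ≈-trans (*-cong ≈-refl (M≈0 _ _ (l′≢l ∘ to-injective))) (zeroʳ _)
    dependent : ∀ (r : Fin (suc n) → R) → ¬ Independent M (suc n) r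
    dependent r independent′ with pigeonhole (n<1+n n) (from ∘ r)
    ... | i , j , i<j , same = 0≉1 (≈-sym (≈-trans (≈-sym coef-i) (independent′ coef combination≈0 i)))
      where
      i≢j : ¬ i ≡ j
      i≢j = <⇒≢ i<j
      rᵢ≡rⱼ : r i ≡ r j
      rᵢ≡rⱼ = from-injective same
      coef : Fin (suc n) → Carrier
      coef l = if does (l ≟F i) then 1# else if does (l ≟F j) then - 1# else 0#
      coef-i : coef i ≈ 1#
      coef-i rewrite dec-true (i ≟F i) refl = ≈-refl
      coef-j : coef j ≈ - 1#
      coef-j rewrite dec-false (j ≟F i) (i≢j ∘ sym) | dec-true (j ≟F j) refl = ≈-refl
      coef-other : ∀ l → ¬ l ≡ i → ¬ l ≡ j → coef l ≈ 0#
      coef-other l l≢i l≢j rewrite dec-false (l ≟F i) l≢i | dec-false (l ≟F j) l≢j = ≈-refl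
      combination≈0 : ∀ c → sumFin (suc n) (λ l → coef l *ᶠ M (r l) c) ≈ 0#
      combination≈0 c = begin
        sumFin (suc n) (λ l → coef l *ᶠ M (r l) c)    ≈⟨ sumFin-two _ _ i j i≢j others ⟩
        coef i *ᶠ M (r i) c +ᶠ coef j *ᶠ M (r j) c    ≈⟨ +-cong (*-cong coef-i ≈-refl)
                                                                 (*-cong coef-j (reflexive (cong (λ r → M r c) (sym rᵢ≡rⱼ)))) ⟩
        1# *ᶠ M (r i) c +ᶠ - 1# *ᶠ M (r i) c          ≈⟨ +-cong (*-identityˡ _) (-1*x≈-x _) ⟩
        M (r i) c +ᶠ - M (r i) c                      ≈⟨ -‿inverseʳ _ ⟩
        0#                                            ∎
        where
        others : ∀ l → ¬ l ≡ i → ¬ l ≡ j → coef l *ᶠ M (r l) c ≈ 0#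
        others l l≢i l≢j = ≈-trans (*-cong (coef-other l l≢i l≢j) ≈-refl) (zeroˡ _)

module Selection {X : Set} (_≟_ : DecidableEquality X) where

  count : X → List X → ℕ
  count y = countᵇ (λ a → does (a ≟ y))

  complement : ∀ {n} → Vec Bool n → Vec Bool n
  complement = Data.Vec.map not

  count-∷ : ∀ x xs y → count y (x ∷ xs) ≡ bit (does (x ≟ y)) + count y xs
  count-∷ x xs y = countᵇ-∷ (λ a → does (a ≟ y)) x xs

  select-∉ : ∀ xs S y → y ∉ xs → count y (select xs S) ≡ 0
  select-∉ []       []           y y∉ = refl
  select-∉ (x ∷ xs) (false ∷ S) y y∉ = select-∉ xs S y (y∉ ∘ there)
  select-∉ (x ∷ xs) (true ∷ S)  y y∉ =
    trans (count-∷ x (select xs S) y)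
          (cong₂ _+_ (cong bit (dec-false (x ≟ y) (y∉ ∘ here ∘ sym))) (select-∉ xs S y (y∉ ∘ there)))

  select-head : ∀ x xs b S → x ∉ xs → count x (select (x ∷ xs) (b ∷ S)) ≡ bit b
  select-head x xs false S x∉ = select-∉ xs S x x∉
  select-head x xs true  S x∉ =
    trans (count-∷ x (select xs S) x) (cong₂ _+_ (cong bit (dec-true (x ≟ x) refl)) (select-∉ xs S x x∉))

  select-tail : ∀ x xs b S y → ¬ x ≡ y → count y (select (x ∷ xs) (b ∷ S)) ≡ count y (select xs S)
  select-tail x xs false S y x≢y = refl
  select-tail x xs true  S y x≢y = trans (count-∷ x (select xs S) y) (cong (_+ _) (cong bit (dec-false (x ≟ y) x≢y)))

  Once : ∀ xs → Vec Bool (length xs) → Vec Bool (length xs) → X → Set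
  Once xs S′ S y = count y (select xs S′) + count y (select xs (complement S)) ≡ 1

  once-complement : ∀ xs S y → Unique xs → y ∈ xs → Once xs S S y
  once-complement (x ∷ xs) (b ∷ S) .x (x∉xs ∷ _) (here refl) =
    trans (cong₂ _+_ (select-head x xs b S x∉) (select-head x xs (not b) (complement S) x∉)) (bits b)
    where
    x∉ : x ∉ xs
    x∉ x∈ = All.lookup x∉xs x∈ refl
    bits : ∀ b → bit b + bit (not b) ≡ 1
    bits true  = refl
    bits false = refl
  once-complement (x ∷ xs) (b ∷ S) y (x∉xs ∷ unique) (there y∈) =
    trans (cong₂ _+_ (select-tail x xs b S y x≢y) (select-tail x xs (not b) (complement S) y x≢y))
          (once-complement xs S y unique y∈)
    where
    x≢y : ¬ x ≡ y
    x≢y = All.lookup x∉xs y∈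

  once⇒≡ : ∀ xs S′ S → Unique xs → (∀ {y} → y ∈ xs → Once xs S′ S y) → S′ ≡ S
  once⇒≡ []       []        []      _                  _    = refl
  once⇒≡ (x ∷ xs) (b′ ∷ S′) (b ∷ S) (x∉xs ∷ unique) once =
    cong₂ _∷_ (heads b′ b (trans (sym (cong₂ _+_ (select-head x xs b′ S′ x∉)
                                                  (select-head x xs (not b) (complement S) x∉)))
                                 (once (here refl))))
              (once⇒≡ xs S′ S unique λ {y} y∈ →
                 trans (sym (cong₂ _+_ (select-tail x xs b′ S′ y (All.lookup x∉xs y∈))
                                       (select-tail x xs (not b) (complement S) y (All.lookup x∉xs y∈))))
                       (once (there y∈)))
    where
    x∉ : x ∉ xs
    x∉ x∈ = All.lookup x∉xs x∈ refl
    heads : ∀ b′ b → bit b′ + bit (not b) ≡ 1 → b′ ≡ b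
    heads true  true  _ = refl
    heads false false _ = refl

-- Restricted paths and their monomials

allX-complete : ∀ m Δ (x : XV m Δ) → x ∈ allX m Δ
allX-complete m zero    (a , b)     = ∈-cartesianProduct⁺ (∈-allFin a) (∈-allFin b)
allX-complete m (suc Δ) (i , j , x) =
  ∈-cartesianProduct⁺ (∈-allFin i) (∈-cartesianProduct⁺ (∈-allFin j) (allX-complete m Δ x))

allY-complete : ∀ m Δ (y : YV m Δ) → y ∈ allY m Δ
allY-complete m zero y = ∈-allFin y
allY-complete m (suc Δ) (i , inj₁ (j , y)) =
  ∈-cartesianProduct⁺ (∈-allFin i)
    (∈-++⁺ˡ (∈-map⁺ inj₁ (∈-cartesianProduct⁺ (∈-allFin j) (allY-complete m Δ y))))
allY-complete m (suc Δ) (i , inj₂ tt) =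
  ∈-cartesianProduct⁺ (∈-allFin i) (∈-++⁺ʳ (map inj₁ (cartesianProduct (allFin 2) (allY m Δ))) (here refl))

allV-complete : ∀ m Δ (v : V m Δ) → v ∈ allV m Δ
allV-complete m Δ (inj₁ y) = ∈-++⁺ˡ (∈-map⁺ inj₁ (allY-complete m Δ y))
allV-complete m Δ (inj₂ z) = ∈-++⁺ʳ (map inj₁ (allY m Δ)) (∈-map⁺ inj₂ (allY-complete m Δ z))

allY-unique : ∀ m Δ → Unique (allY m Δ)
allY-unique m zero    = Unique.allFin⁺ 2
allY-unique m (suc Δ) = Unique.cartesianProduct⁺ (Unique.allFin⁺ m)
  (Unique.++⁺ (Unique.map⁺ inj₁-injective (Unique.cartesianProduct⁺ (Unique.allFin⁺ 2) (allY-unique m Δ)))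
              ([] ∷ []) fresh∉copies)
  where
  fresh∉copies : Disjoint (map inj₁ (cartesianProduct (allFin 2) (allY m Δ))) (inj₂ tt ∷ [])
  fresh∉copies (inj₂∈ , here refl) with ∈-map⁻ inj₁ inj₂∈
  ... | _ , _ , ()

liftV : ∀ {m Δ} → Fin m → Fin 2 → V m Δ → V m (suc Δ)
liftV i j (inj₁ y) = inj₁ (i , inj₁ (j , y))
liftV i j (inj₂ z) = inj₂ (i , inj₁ (j , z))

liftV-injective : ∀ {m Δ} (i : Fin m) (j : Fin 2) → Injective _≡_ _≡_ (liftV {Δ = Δ} i j)
liftV-injective i j {inj₁ _} {inj₁ _} refl = refl
liftV-injective i j {inj₂ _} {inj₂ _} refl = refl

module _ {m Δ : ℕ} where

  consTgt : Tgt m Δ → Maybe (List (V m Δ)) → Maybe (List (V m Δ))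
  consTgt _      nothing   = nothing
  consTgt (ty y) (just vs) = just (inj₁ y ∷ vs)
  consTgt (tz z) (just vs) = just (inj₂ z ∷ vs)
  consTgt zer    (just _)  = nothing
  consTgt one    (just vs) = just vs

  restrictMon-∷ : (ρ : XV m Δ → Tgt m Δ) (x : XV m Δ) (p : List (XV m Δ)) →
    restrictMon ρ (x ∷ p) ≡ consTgt (ρ x) (restrictMon ρ p)
  restrictMon-∷ ρ x p with restrictMon ρ p
  ... | nothing = refl
  ... | just vs with ρ x
  ...   | ty _ = refl
  ...   | tz _ = refl
  ...   | zer  = refl
  ...   | one  = refl

  consTgt-zipWith : (t : Tgt m Δ) (r s : Maybe (List (V m Δ))) →
    consTgt t (zipWith _++_ r s) ≡ zipWith _++_ (consTgt t r) s
  consTgt-zipWith t      nothing   s        = refl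
  consTgt-zipWith (ty _) (just _)  nothing  = refl
  consTgt-zipWith (tz _) (just _)  nothing  = refl
  consTgt-zipWith zer    (just _)  nothing  = refl
  consTgt-zipWith one    (just _)  nothing  = refl
  consTgt-zipWith (ty _) (just _)  (just _) = refl
  consTgt-zipWith (tz _) (just _)  (just _) = refl
  consTgt-zipWith zer    (just _)  (just _) = refl
  consTgt-zipWith one    (just _)  (just _) = refl

  restrictMon-++ : (ρ : XV m Δ → Tgt m Δ) (p q : List (XV m Δ)) →
    restrictMon ρ (p ++ q) ≡ zipWith _++_ (restrictMon ρ p) (restrictMon ρ q)
  restrictMon-++ ρ [] q with restrictMon ρ q
  ... | nothing = refl
  ... | just _  = refl
  restrictMon-++ ρ (x ∷ p) q = begin
    restrictMon ρ (x ∷ p ++ q)                                   ≡⟨ restrictMon-∷ ρ x (p ++ q) ⟩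
    consTgt (ρ x) (restrictMon ρ (p ++ q))                        ≡⟨ cong (consTgt (ρ x)) (restrictMon-++ ρ p q) ⟩
    consTgt (ρ x) (zipWith _++_ (restrictMon ρ p) (restrictMon ρ q))
      ≡⟨ consTgt-zipWith (ρ x) (restrictMon ρ p) (restrictMon ρ q) ⟩
    zipWith _++_ (consTgt (ρ x) (restrictMon ρ p)) (restrictMon ρ q)
      ≡⟨ cong (λ r → zipWith _++_ r (restrictMon ρ q)) (restrictMon-∷ ρ x p) ⟨
    zipWith _++_ (restrictMon ρ (x ∷ p)) (restrictMon ρ q)       ∎
    where open ≡-Reasoning

  restrictMon-killed : (ρ : XV m Δ → Tgt m Δ) (x : XV m Δ) (p : List (XV m Δ)) → ρ x ≡ zer →
    restrictMon ρ (x ∷ p) ≡ nothing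
  restrictMon-killed ρ x p ρx≡0 rewrite restrictMon-∷ ρ x p | ρx≡0 with restrictMon ρ p
  ... | nothing = refl
  ... | just _  = refl

consTgt-just⁻ : ∀ {m Δ} (t : Tgt m Δ) (r : Maybe (List (V m Δ))) {vs} → consTgt t r ≡ just vs →
  ∃ λ vs′ → r ≡ just vs′ × ¬ t ≡ zer
consTgt-just⁻ (ty _) (just vs′) _ = vs′ , refl , λ ()
consTgt-just⁻ (tz _) (just vs′) _ = vs′ , refl , λ ()
consTgt-just⁻ one    (just vs′) _ = vs′ , refl , λ ()

module _ {m Δ : ℕ} (i : Fin m) (j : Fin 2) where

  consTgt-lift : (t : Tgt m Δ) (r : Maybe (List (V m Δ))) →
    consTgt (liftT i j t) (mapᴹ (map (liftV i j)) r) ≡ mapᴹ (map (liftV i j)) (consTgt t r)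
  consTgt-lift t      nothing  = refl
  consTgt-lift (ty _) (just _) = refl
  consTgt-lift (tz _) (just _) = refl
  consTgt-lift zer    (just _) = refl
  consTgt-lift one    (just _) = refl

  restrictMon-emb : (σ : XV m (suc Δ) → Tgt m (suc Δ)) (τ : XV m Δ → Tgt m Δ) →
    (∀ x → σ (i , j , x) ≡ liftT i j (τ x)) → (p : List (XV m Δ)) →
    restrictMon σ (emb i j p) ≡ mapᴹ (map (liftV i j)) (restrictMon τ p)
  restrictMon-emb σ τ σ≡τ [] = refl
  restrictMon-emb σ τ σ≡τ (x ∷ p) = begin
    restrictMon σ ((i , j , x) ∷ emb i j p)                 ≡⟨ restrictMon-∷ σ (i , j , x) (emb i j p) ⟩
    consTgt (σ (i , j , x)) (restrictMon σ (emb i j p))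
      ≡⟨ cong₂ consTgt (σ≡τ x) (restrictMon-emb σ τ σ≡τ p) ⟩
    consTgt (liftT i j (τ x)) (mapᴹ (map (liftV i j)) (restrictMon τ p))
      ≡⟨ consTgt-lift (τ x) (restrictMon τ p) ⟩
    mapᴹ (map (liftV i j)) (consTgt (τ x) (restrictMon τ p))
      ≡⟨ cong (mapᴹ (map (liftV i j))) (restrictMon-∷ τ x p) ⟨
    mapᴹ (map (liftV i j)) (restrictMon τ (x ∷ p))          ∎
    where open ≡-Reasoning

module _ {m Δ : ℕ} where

  TgtAll : (V m Δ → Set) → Tgt m Δ → Set
  TgtAll Q (ty y) = Q (inj₁ y)
  TgtAll Q (tz z) = Q (inj₂ z)
  TgtAll Q zer    = ⊤
  TgtAll Q one    = ⊤

  restrictMon-All : (Q : V m Δ → Set) (ρ : XV m Δ → Tgt m Δ) {p : List (XV m Δ)} →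
    All (λ x → TgtAll Q (ρ x)) p → ∀ {vs} → restrictMon ρ p ≡ just vs → All Q vs
  restrictMon-All Q ρ [] refl = []
  restrictMon-All Q ρ {x ∷ p} (q ∷ qs) e rewrite restrictMon-∷ ρ x p with restrictMon ρ p in e′
  ... | just vs′ = consTgt-All (ρ x) q (restrictMon-All Q ρ qs e′) e
    where
    consTgt-All : ∀ t → TgtAll Q t → All Q vs′ → ∀ {vs} → consTgt t (just vs′) ≡ just vs → All Q vs
    consTgt-All (ty _) q qs refl = q ∷ qs
    consTgt-All (tz _) q qs refl = q ∷ qs
    consTgt-All one    _ qs refl = qs

  HasExponents : List (V m Δ) → (V m Δ → ℕ) → Set
  HasExponents vs w = ∀ v → expo v vs ≡ w v

  monomialHas : (V m Δ → ℕ) → Maybe (List (V m Δ)) → Bool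
  monomialHas w nothing   = false
  monomialHas w (just vs) = all (λ v → expo v vs ≡ᵇ w v) (allV m Δ)

  yields : (XV m Δ → Tgt m Δ) → (V m Δ → ℕ) → List (XV m Δ) → Bool
  yields ρ w p = monomialHas w (restrictMon ρ p)

  Yields : (XV m Δ → Tgt m Δ) → (V m Δ → ℕ) → List (XV m Δ) → Set
  Yields ρ w p = ∃ λ vs → restrictMon ρ p ≡ just vs × HasExponents vs w

  yields-sound : ∀ ρ w p → yields ρ w p ≡ true → Yields ρ w p
  yields-sound ρ w p e with restrictMon ρ p
  ... | just vs = vs , refl , λ v → ≡ᵇ⇒≡ _ _ (≡true⇒T (all-sound _ e (allV-complete m Δ v)))

  yields-complete : ∀ ρ w p → Yields ρ w p → yields ρ w p ≡ true
  yields-complete ρ w p (vs , e , has) rewrite e =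
    all-complete _ (allV m Δ) (λ {v} _ → T⇒≡true (≡⇒≡ᵇ _ _ (has v)))

  yields-≡ : ∀ ρ w p ρ′ w′ p′ → (Yields ρ w p → Yields ρ′ w′ p′) → (Yields ρ′ w′ p′ → Yields ρ w p) →
    yields ρ w p ≡ yields ρ′ w′ p′
  yields-≡ ρ w p ρ′ w′ p′ f g =
    Bool-≡ (yields-complete ρ′ w′ p′ ∘ f ∘ yields-sound ρ w p) (yields-complete ρ w p ∘ g ∘ yields-sound ρ′ w′ p′)

  yields-killed : ∀ ρ w p → restrictMon ρ p ≡ nothing → yields ρ w p ≡ false
  yields-killed ρ w p e rewrite e = refl

coeff : ∀ m Δ → Choice m Δ → (V m Δ → ℕ) → ℕ
coeff m Δ ch w = countᵇ (yields (rho m Δ ch) w) (pathMons m Δ)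

data Side : Set where
  ySide zSide : Side

opposite : Side → Side
opposite ySide = zSide
opposite zSide = ySide

module _ {m Δ : ℕ} where

  tgtOn : Side → YV m Δ → Tgt m Δ
  tgtOn ySide = ty
  tgtOn zSide = tz

  varOn : Side → YV m Δ → V m Δ
  varOn ySide = inj₁
  varOn zSide = inj₂

InImage : ∀ m Δ → Choice m Δ → Side → YV m Δ → Set
InImage m Δ ch s y = ∃ λ x → rho m Δ ch x ≡ tgtOn s y

-- Ỹ and Z̃ carry the same indices (inImage-opposite), and IsTransversal w says that
-- x^w is a monomial of ∏_{k ∈ Ỹ} (y_k + z_k).
TransversalAt : ∀ m Δ → Choice m Δ → (V m Δ → ℕ) → YV m Δ → Set
TransversalAt m Δ ch w y =
  (InImage m Δ ch ySide y → w (inj₁ y) + w (inj₂ y) ≡ 1) ×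
  (¬ InImage m Δ ch ySide y → w (inj₁ y) ≡ 0 × w (inj₂ y) ≡ 0)

IsTransversal : ∀ m Δ → Choice m Δ → (V m Δ → ℕ) → Set
IsTransversal m Δ ch w = ∀ y → TransversalAt m Δ ch w y

module Level0 (m : ℕ) where

  inImage : ∀ s (y : YV m zero) → InImage m zero tt s y
  inImage ySide zero       = (zero , zero) , refl
  inImage ySide (suc zero) = (suc (suc zero) , zero) , refl
  inImage zSide zero       = (suc zero , zero) , refl
  inImage zSide (suc zero) = (suc (suc (suc zero)) , zero) , refl

  pairPaths : Fin 2 → List (List (XV m zero))
  pairPaths zero       = piLab zero ∷ piLab (suc zero) ∷ []
  pairPaths (suc zero) = piLab (suc (suc zero)) ∷ piLab (suc (suc (suc zero))) ∷ []

  module _ (w : V m zero → ℕ) where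

    -- G^(0) is the series composition of two parallel pairs, one for each of y_k + z_k.
    pairYields : Fin 2 → List (XV m zero) → Bool
    pairYields k p with restrictMon (rho0 {m}) p
    ... | nothing = false
    ... | just vs = (expo {m} (inj₁ k) vs ≡ᵇ w (inj₁ k)) ∧ (expo {m} (inj₂ k) vs ≡ᵇ w (inj₂ k))

    private
      exponentIs : ℕ → V m zero → Bool
      exponentIs e v = e ≡ᵇ w v
      y₁ y₂ z₁ z₂ : V m zero
      y₁ = inj₁ zero
      y₂ = inj₁ (suc zero)
      z₁ = inj₂ zero
      z₂ = inj₂ (suc zero)

    yields-factors : ∀ {a b} → a ∈ pairPaths zero → b ∈ pairPaths (suc zero) →
      yields (rho0 {m}) w (a ++ b) ≡ pairYields zero a ∧ pairYields (suc zero) b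
    yields-factors (here refl)         (here refl)         =
      ∧-interleave (exponentIs 1 y₁) (exponentIs 1 y₂) (exponentIs 0 z₁) (exponentIs 0 z₂)
    yields-factors (here refl)         (there (here refl)) =
      ∧-interleave (exponentIs 1 y₁) (exponentIs 0 y₂) (exponentIs 0 z₁) (exponentIs 1 z₂)
    yields-factors (there (here refl)) (here refl)         =
      ∧-interleave (exponentIs 0 y₁) (exponentIs 1 y₂) (exponentIs 1 z₁) (exponentIs 0 z₂)
    yields-factors (there (here refl)) (there (here refl)) =
      ∧-interleave (exponentIs 0 y₁) (exponentIs 0 y₂) (exponentIs 1 z₁) (exponentIs 1 z₂)

    pair-indicator : ∀ k → Indicator (countᵇ (pairYields k) (pairPaths k)) (w (inj₁ k) + w (inj₂ k) ≡ 1)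
    pair-indicator zero       =
      Indicator-resp (sym (countᵇ-pair (pairYields zero) (piLab zero) (piLab (suc zero)))) (λ e → e) (λ e → e)
        (sum≡1-indicator (w (inj₁ zero)) (w (inj₂ zero)))
    pair-indicator (suc zero) =
      Indicator-resp (sym (countᵇ-pair (pairYields (suc zero)) (piLab (suc (suc zero))) (piLab (suc (suc (suc zero))))))
        (λ e → e) (λ e → e) (sum≡1-indicator (w (inj₁ (suc zero))) (w (inj₂ (suc zero))))

    coeff-indicator : Indicator (coeff m zero tt w) (IsTransversal m zero tt w)
    coeff-indicator =
      Indicator-resp (sym (countᵇ-cartesianProductWith _++_ (yields rho0 w) (pairYields zero) (pairYields (suc zero))
                                                        (pairPaths zero) (pairPaths (suc zero)) yields-factors))
        (λ (e₀ , e₁) → λ { zero       → (λ _ → e₀) , (λ ∉ → ⊥-elim (∉ (inImage ySide zero)))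
                         ; (suc zero) → (λ _ → e₁) , (λ ∉ → ⊥-elim (∉ (inImage ySide (suc zero)))) })
        (λ tr → proj₁ (tr zero) (inImage ySide zero) , proj₁ (tr (suc zero)) (inImage ySide (suc zero)))
        (Indicator-* (pair-indicator zero) (pair-indicator (suc zero)))

-- Paths of G^(Δ) that are determined by their edges

module _ {m Δ : ℕ} where

  block : Fin m → List (List (XV m (suc Δ)))
  block i = map (emb i zero) (pathMons m Δ) ++ map (emb i (suc zero)) (pathMons m Δ)

  seriesOf : List (Fin m) → List (List (XV m (suc Δ)))
  seriesOf is = seriesMons (map block is)

  InBlock : Fin m → List (XV m (suc Δ)) → Set
  InBlock i = All (λ x → proj₁ x ≡ i)

  AvoidsBlock : Fin m → List (XV m (suc Δ)) → Set
  AvoidsBlock i = All (λ x → ¬ proj₁ x ≡ i)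

  emb-inBlock : ∀ i j (p : List (XV m Δ)) → InBlock i (emb i j p)
  emb-inBlock i j p = map⁺ (All.universal (λ _ → refl) p)

  block-inBlock : ∀ i → All (InBlock i) (block i)
  block-inBlock i = ++⁺ (map⁺ (All.universal (emb-inBlock i zero) (pathMons m Δ)))
                        (map⁺ (All.universal (emb-inBlock i (suc zero)) (pathMons m Δ)))

  seriesOf-avoidsBlock : ∀ i is → All (λ i′ → ¬ i ≡ i′) is → All (AvoidsBlock i) (seriesOf is)
  seriesOf-avoidsBlock i [] [] = [] ∷ []
  seriesOf-avoidsBlock i (i′ ∷ is) (i≢i′ ∷ i∉is) =
    cartesianProductWith⁺ (setoid _) (setoid _) _++_ (block i′) (seriesOf is) λ a∈ b∈ →
      ++⁺ (All.map (λ { refl → i≢i′ ∘ sym }) (All.lookup (block-inBlock i′) a∈))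
          (All.lookup (seriesOf-avoidsBlock i is i∉is) b∈)

NonEmptyPaths : ∀ m Δ → Set
NonEmptyPaths m Δ = All (λ p → ¬ p ≡ []) (pathMons m Δ)

nonEmptyPaths : ∀ m Δ → NonEmptyPaths (suc m) Δ
nonEmptyPaths m zero    = (λ ()) ∷ (λ ()) ∷ (λ ()) ∷ (λ ()) ∷ []
nonEmptyPaths m (suc Δ) =
  cartesianProductWith⁺ (setoid _) (setoid _) _++_ (block zero) _ λ a∈ _ → ++-nonEmpty (All.lookup firstBlock a∈)
  where
  emb-nonEmpty : ∀ j → All (λ p → ¬ p ≡ []) (map (emb {Δ = Δ} zero j) (pathMons (suc m) Δ))
  emb-nonEmpty j = map⁺ (All.map (λ { {x ∷ p} _ () ; {[]} p≢[] → ⊥-elim (p≢[] refl) }) (nonEmptyPaths m Δ))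
  firstBlock : All (λ p → ¬ p ≡ []) (block zero)
  firstBlock = ++⁺ (emb-nonEmpty zero) (emb-nonEmpty (suc zero))
  ++-nonEmpty : ∀ {a b : List (XV (suc m) (suc Δ))} → ¬ a ≡ [] → ¬ a ++ b ≡ []
  ++-nonEmpty {[]} a≢[] = ⊥-elim (a≢[] refl)
  ++-nonEmpty {_ ∷ _} _ ()

module _ {m Δ : ℕ} where

  liesOn : List (XV m Δ) → List (XV m Δ) → Bool
  liesOn q p = all (λ x → elemX x q) p

  OnlyPathOn : List (XV m Δ) → Set
  OnlyPathOn q = filterᵇ (liesOn q) (pathMons m Δ) ≡ q ∷ []

  elemX-∈ : ∀ {x : XV m Δ} {q} → x ∈ q → elemX x q ≡ true
  elemX-∈ {x} x∈q = any-complete _ x∈q (dec-true (x ≟X x) refl)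

  elemX-∉ : ∀ (x : XV m Δ) {q} → All (λ x′ → ¬ x ≡ x′) q → elemX x q ≡ false
  elemX-∉ x {q} x∉q = any-none _ {q} (All.map (dec-false (x ≟X _)) x∉q)

  liesOn-self : ∀ q → liesOn q q ≡ true
  liesOn-self q = all-complete _ q elemX-∈

  occ : XV m Δ → List (XV m Δ) → ℕ
  occ x = countᵇ (λ x′ → does (x′ ≟X x))

  occ≢0⇒elemX : ∀ x q → ¬ occ x q ≡ 0 → elemX x q ≡ true
  occ≢0⇒elemX x [] occ≢0 = ⊥-elim (occ≢0 refl)
  occ≢0⇒elemX x (x′ ∷ q) occ≢0 with x′ ≟X x
  ... | yes refl = elemX-∈ {q = x ∷ q} (here refl)
  ... | no _     = ∨-introʳ (does (x ≟X x′)) {elemX x q} (occ≢0⇒elemX x q occ≢0)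

module _ {m Δ : ℕ} (i : Fin m) (j : Fin 2) where

  emb-injective : Injective _≡_ _≡_ (λ (x : XV m Δ) → (i , j , x))
  emb-injective refl = refl

  elemX-emb : ∀ x (r : List (XV m Δ)) → elemX {m} {suc Δ} (i , j , x) (emb i j r) ≡ elemX x r
  elemX-emb x []      = refl
  elemX-emb x (x′ ∷ r) = cong₂ _∨_ (does-injective (_≟X_ {m} {Δ}) (_≟X_ {m} {suc Δ}) emb-injective x x′) (elemX-emb x r)

  liesOn-emb : ∀ (r p : List (XV m Δ)) → liesOn {m} {suc Δ} (emb i j r) (emb i j p) ≡ liesOn r p
  liesOn-emb r []      = refl
  liesOn-emb r (x ∷ p) = cong₂ _∧_ (elemX-emb x r) (liesOn-emb r p)

  liesOn-otherCopy : ∀ {j′} → ¬ j′ ≡ j → ∀ (r p : List (XV m Δ)) → ¬ p ≡ [] →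
    liesOn {m} {suc Δ} (emb i j r) (emb i j′ p) ≡ false
  liesOn-otherCopy j′≢j r []      p≢[] = ⊥-elim (p≢[] refl)
  liesOn-otherCopy {j′} j′≢j r (x ∷ p) _ =
    cong (_∧ liesOn {m} {suc Δ} (emb i j r) (emb i j′ p))
         (elemX-∉ {m} {suc Δ} (i , j′ , x) {emb i j r} (map⁺ (All.universal (λ _ e → j′≢j (cong (proj₁ ∘ proj₂) e)) r)))

module _ {m Δ : ℕ} (i : Fin m) where

  block-onlyPathOn : ∀ j r → OnlyPathOn r → NonEmptyPaths m Δ →
    filterᵇ (liesOn {m} {suc Δ} (emb i j r)) (block {Δ = Δ} i) ≡ emb i j r ∷ []
  block-onlyPathOn j r only nonEmpty = begin
    filterᵇ (liesOn {m} {suc Δ} (emb i j r)) (block {Δ = Δ} i)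
      ≡⟨ filter-++ (T? ∘ liesOn {m} {suc Δ} (emb i j r)) (map (emb i zero) (pathMons m Δ)) _ ⟩
    copy zero ++ copy (suc zero)
      ≡⟨ copies j sameCopy otherCopy ⟩
    emb i j r ∷ [] ∎
    where
    open ≡-Reasoning
    copy : Fin 2 → List (List (XV m (suc Δ)))
    copy j′ = filterᵇ (liesOn {m} {suc Δ} (emb i j r)) (map (emb i j′) (pathMons m Δ))
    sameCopy : copy j ≡ emb i j r ∷ []
    sameCopy = trans (filterᵇ-map _ (emb i j) (pathMons m Δ))
                     (cong (map (emb i j))
                           (trans (filterᵇ-cong {xs = pathMons m Δ} (All.universal (liesOn-emb i j r) _)) only))
    otherCopy : ∀ {j′} → ¬ j′ ≡ j → copy j′ ≡ []
    otherCopy {j′} j′≢j = trans (filterᵇ-map _ (emb i j′) (pathMons m Δ))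
      (cong (map (emb i j′)) (filterᵇ-none (All.map (λ {p} → liesOn-otherCopy i j j′≢j r p) nonEmpty)))
    copies : ∀ j → copy j ≡ emb i j r ∷ [] → (∀ {j′} → ¬ j′ ≡ j → copy j′ ≡ []) →
             copy zero ++ copy (suc zero) ≡ emb i j r ∷ []
    copies zero       this others = cong₂ _++_ this (others (λ ()))
    copies (suc zero) this others = cong₂ _++_ (others (λ ())) this

module _ {m Δ : ℕ} where

  BlockwiseOnly : (Fin m → List (XV m (suc Δ))) → Set
  BlockwiseOnly h = ∀ i → ∃ λ j → ∃ λ r → h i ≡ emb i j r × OnlyPathOn {m} {Δ} r

  blockwise-inBlock : ∀ {h} → BlockwiseOnly h → ∀ i → InBlock i (h i)
  blockwise-inBlock only i with only i
  ... | j , r , hi≡ , _ rewrite hi≡ = emb-inBlock i j r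

  concat-avoidsBlock : ∀ {h} → BlockwiseOnly h → ∀ i is → All (λ i′ → ¬ i ≡ i′) is → AvoidsBlock i (concat (map h is))
  concat-avoidsBlock only i []        []            = []
  concat-avoidsBlock only i (i′ ∷ is) (i≢i′ ∷ i∉is) =
    ++⁺ (All.map (λ { refl → i≢i′ ∘ sym }) (blockwise-inBlock only i′)) (concat-avoidsBlock only i is i∉is)

  seriesOf-onlyPathOn : ∀ {h} → BlockwiseOnly h → NonEmptyPaths m Δ → (is : List (Fin m)) → Unique is →
    filterᵇ (liesOn {m} {suc Δ} (concat (map h is))) (seriesOf {Δ = Δ} is) ≡ concat (map h is) ∷ []
  seriesOf-onlyPathOn only nonEmpty []        []            = refl
  seriesOf-onlyPathOn {h} only nonEmpty (i ∷ is) (i∉is ∷ unique) =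
    trans (filterᵇ-cartesianProductWith _++_ (liesOnˢ q) (liesOnˢ (h i)) (liesOnˢ rest) (block {Δ = Δ} i)
             (seriesOf is) (λ a∈ b∈ → liesOn-split (All.lookup (block-inBlock {Δ = Δ} i) a∈)
                                                 (All.lookup (seriesOf-avoidsBlock {Δ = Δ} i is i∉is) b∈)))
          (cong₂ (cartesianProductWith _++_) thisBlock (seriesOf-onlyPathOn only nonEmpty is unique))
    where
    elemXˢ : XV m (suc Δ) → List (XV m (suc Δ)) → Bool
    elemXˢ = elemX {m} {suc Δ}
    liesOnˢ : List (XV m (suc Δ)) → List (XV m (suc Δ)) → Bool
    liesOnˢ = liesOn {m} {suc Δ}
    rest q : List (XV m (suc Δ))
    rest = concat (map h is)
    q = h i ++ rest
    thisBlock : filterᵇ (liesOnˢ (h i)) (block {Δ = Δ} i) ≡ h i ∷ []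
    thisBlock = let j , r , hi≡ , r-only = only i in
      subst (λ p → filterᵇ (liesOnˢ p) (block {Δ = Δ} i) ≡ p ∷ []) (sym hi≡) (block-onlyPathOn i j r r-only nonEmpty)
    inThis : ∀ {x} → proj₁ x ≡ i → elemXˢ x q ≡ elemXˢ x (h i)
    inThis {x} x∈i = begin
      elemXˢ x (h i ++ rest)               ≡⟨ any-++ (λ x′ → does (_≟X_ {m} {suc Δ} x x′)) (h i) rest ⟩
      elemXˢ x (h i) ∨ elemXˢ x rest       ≡⟨ cong (elemXˢ x (h i) ∨_) (elemX-∉ {m} {suc Δ} x rest∌x) ⟩
      elemXˢ x (h i) ∨ false               ≡⟨ ∨-identityʳ _ ⟩
      elemXˢ x (h i)                       ∎
      where
      open ≡-Reasoning
      rest∌x : All (λ x′ → ¬ x ≡ x′) rest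
      rest∌x = All.map (λ i′≢i e → i′≢i (trans (cong proj₁ (sym e)) x∈i)) (concat-avoidsBlock only i is i∉is)
    notInThis : ∀ {x} → ¬ proj₁ x ≡ i → elemXˢ x q ≡ elemXˢ x rest
    notInThis {x} x∉i = trans (any-++ (λ x′ → does (_≟X_ {m} {suc Δ} x x′)) (h i) rest)
      (cong (_∨ elemXˢ x rest) (elemX-∉ {m} {suc Δ} x hi∌x))
      where
      hi∌x : All (λ x′ → ¬ x ≡ x′) (h i)
      hi∌x = All.map (λ e≡i e → x∉i (trans (cong proj₁ e) e≡i)) (blockwise-inBlock only i)
    liesOn-split : ∀ {a b} → InBlock {Δ = Δ} i a → AvoidsBlock i b →
      liesOnˢ q (a ++ b) ≡ liesOnˢ (h i) a ∧ liesOnˢ rest b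
    liesOn-split {a} {b} a∈i b∉i =
      trans (all-++ (λ x → elemXˢ x q) a b)
            (cong₂ _∧_ (all-cong {p = λ x → elemXˢ x q} (All.map inThis a∈i))
                       (all-cong {p = λ x → elemXˢ x q} (All.map notInThis b∉i)))

onlyPathOn-minPath : ∀ m Δ → OnlyPathOn (minPath (suc m) Δ)
onlyPathOn-minPath m zero    = refl
onlyPathOn-minPath m (suc Δ) =
  seriesOf-onlyPathOn (λ i → zero , minPath (suc m) Δ , refl , onlyPathOn-minPath m Δ) (nonEmptyPaths m Δ)
    (allFin (suc m)) (Unique.allFin⁺ (suc m))

-- lexPath m (suc Δ) (i , j , x) unfolds to concatMap (lexBlock i j x) (allFin m).
lexBlock : ∀ {m Δ} → Fin m → Fin 2 → XV m Δ → Fin m → List (XV m (suc Δ))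
lexBlock {m} {Δ} i j x i′ = if does (i′ ≟F i) then emb i j (lexPath m Δ x) else emb i′ zero (minPath m Δ)

onlyPathOn-lexPath : ∀ m Δ x → OnlyPathOn (lexPath (suc m) Δ x)
onlyPathOn-lexPath m zero (zero , _)                 = refl
onlyPathOn-lexPath m zero (suc zero , _)             = refl
onlyPathOn-lexPath m zero (suc (suc zero) , _)       = refl
onlyPathOn-lexPath m zero (suc (suc (suc zero)) , _) = refl
onlyPathOn-lexPath m (suc Δ) (i , j , x) =
  seriesOf-onlyPathOn blockwise (nonEmptyPaths m Δ) (allFin (suc m)) (Unique.allFin⁺ (suc m))
  where
  blockwise : BlockwiseOnly (lexBlock i j x)
  blockwise i′ with i′ ≟F i
  ... | yes refl = j , lexPath (suc m) Δ x , refl , onlyPathOn-lexPath m Δ x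
  ... | no _     = zero , minPath (suc m) Δ , refl , onlyPathOn-minPath m Δ

module _ {m Δ : ℕ} where

  occ-emb : ∀ i j (x : XV m Δ) r → occ {m} {suc Δ} (i , j , x) (emb i j r) ≡ occ x r
  occ-emb i j x r = trans (countᵇ-map _ (λ y → i , j , y) r)
    (cong length (filterᵇ-cong (All.universal (λ y → does-injective _≟X_ (_≟X_ {m} {suc Δ}) (emb-injective i j) y x) r)))

  occ-otherBlock : ∀ {i i′} → ¬ i′ ≡ i → ∀ j j′ (x : XV m Δ) r → occ {m} {suc Δ} (i , j , x) (emb i′ j′ r) ≡ 0
  occ-otherBlock i′≢i j j′ x r = trans (countᵇ-map _ (λ y → _ , j′ , y) r)
    (cong length (filterᵇ-none (All.universal (λ y → dec-false (_≟X_ {m} {suc Δ} _ _) (i′≢i ∘ cong proj₁)) r)))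

occ-lexPath : ∀ m Δ x → occ x (lexPath m Δ x) ≡ 1
occ-lexPath m zero (zero , zero)                     = refl
occ-lexPath m zero (zero , suc zero)                 = refl
occ-lexPath m zero (suc zero , zero)                 = refl
occ-lexPath m zero (suc zero , suc zero)             = refl
occ-lexPath m zero (suc (suc zero) , zero)           = refl
occ-lexPath m zero (suc (suc zero) , suc zero)       = refl
occ-lexPath m zero (suc (suc (suc zero)) , zero)     = refl
occ-lexPath m zero (suc (suc (suc zero)) , suc zero) = refl
occ-lexPath m (suc Δ) (i , j , x) =
  trans (countᵇ-concatMap (λ x′ → does (_≟X_ {m} {suc Δ} x′ (i , j , x))) (lexBlock i j x) (λ i′ → does (i′ ≟F i))
                          perBlock (allFin m))
        (countᵇ-≟-unique _≟F_ (Unique.allFin⁺ m) (∈-allFin i))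
  where
  perBlock : ∀ i′ → occ {m} {suc Δ} (i , j , x) (lexBlock i j x i′) ≡ bit (does (i′ ≟F i))
  perBlock i′ with i′ ≟F i
  ... | yes refl = trans (occ-emb i j x (lexPath m Δ x)) (occ-lexPath m Δ x)
  ... | no i′≢i  = occ-otherBlock i′≢i j zero x (minPath m Δ)

-- Series composition: coefficients factor over blocks

module _ {m Δ : ℕ} where

  yields-cong : ∀ (ρ : XV m Δ → Tgt m Δ) {w w′} → (∀ v → w v ≡ w′ v) → ∀ p → yields ρ w p ≡ yields ρ w′ p
  yields-cong ρ {w} {w′} w≗w′ p = yields-≡ ρ w p ρ w′ p
    (λ (vs , e , has) → vs , e , λ v → trans (has v) (w≗w′ v))
    (λ (vs , e , has) → vs , e , λ v → trans (has v) (sym (w≗w′ v)))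

  hasExponents-++ : ∀ {va vb : List (V m Δ)} {w wa wb} → (∀ v → w v ≡ wa v + wb v) →
    (∀ v → (expo v va ≡ 0 × wa v ≡ 0) ⊎ (expo v vb ≡ 0 × wb v ≡ 0)) →
    HasExponents (va ++ vb) w → HasExponents va wa × HasExponents vb wb
  hasExponents-++ {va} {vb} {w} {wa} {wb} w≡ disjoint has = (λ v → proj₁ (split v)) , (λ v → proj₂ (split v))
    where
    split : ∀ v → expo v va ≡ wa v × expo v vb ≡ wb v
    split v with disjoint v | trans (sym (countᵇ-++ _ va vb)) (trans (has v) (w≡ v))
    ... | inj₁ (a≡0 , wa≡0) | sum≡ rewrite a≡0 | wa≡0 = refl , sum≡
    ... | inj₂ (b≡0 , wb≡0) | sum≡ rewrite b≡0 | wb≡0 = trans (sym (ℕₚ.+-identityʳ _)) (trans sum≡ (ℕₚ.+-identityʳ _)) , refl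

  hasExponents-++⁺ : ∀ {va vb : List (V m Δ)} {w wa wb} → (∀ v → w v ≡ wa v + wb v) →
    HasExponents va wa → HasExponents vb wb → HasExponents (va ++ vb) w
  hasExponents-++⁺ {va} {vb} w≡ hasa hasb v =
    trans (countᵇ-++ _ va vb) (trans (cong₂ _+_ (hasa v) (hasb v)) (sym (w≡ v)))

  expo-none : ∀ v (vs : List (V m Δ)) → All (λ u → ¬ u ≡ v) vs → expo v vs ≡ 0
  expo-none v vs none = cong length (filterᵇ-none (All.map (dec-false (_ ≟V v)) none))

module _ {m Δ : ℕ} where

  blockOfV : V m (suc Δ) → Fin m
  blockOfV (inj₁ (i , _)) = i
  blockOfV (inj₂ (i , _)) = i

  restrictTo : List (Fin m) → (V m (suc Δ) → ℕ) → V m (suc Δ) → ℕ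
  restrictTo is w v = if any (λ i → does (blockOfV v ≟F i)) is then w v else 0

  restrictTo-∉ : ∀ {is} w v → All (λ i → ¬ blockOfV v ≡ i) is → restrictTo is w v ≡ 0
  restrictTo-∉ w v v∉is rewrite any-none _ (All.map (dec-false (blockOfV v ≟F _)) v∉is) = refl

  restrictTo-here : ∀ i is w v → blockOfV v ≡ i → restrictTo (i ∷ is) w v ≡ w v
  restrictTo-here i is w v refl rewrite dec-true (blockOfV v ≟F blockOfV v) refl = refl

  restrictTo-there : ∀ i is w v → ¬ blockOfV v ≡ i → restrictTo (i ∷ is) w v ≡ restrictTo is w v
  restrictTo-there i is w v v∉i rewrite dec-false (blockOfV v ≟F i) v∉i = refl

  restrictTo-allFin : ∀ w v → restrictTo (allFin m) w v ≡ w v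
  restrictTo-allFin w v rewrite any-complete (λ i → does (blockOfV v ≟F i)) (∈-allFin (blockOfV v))
                                             (dec-true (blockOfV v ≟F blockOfV v) refl) = refl

  restrictTo-∷ : ∀ i is → All (λ i′ → ¬ i ≡ i′) is → ∀ w v →
    restrictTo (i ∷ is) w v ≡ restrictTo (i ∷ []) w v + restrictTo is w v
  restrictTo-∷ i is i∉is w v = byBlock (blockOfV v ≟F i)
    where
    open ≡-Reasoning
    byBlock : Dec (blockOfV v ≡ i) → restrictTo (i ∷ is) w v ≡ restrictTo (i ∷ []) w v + restrictTo is w v
    byBlock (yes v∈i) = begin
      restrictTo (i ∷ is) w v                      ≡⟨ restrictTo-here i is w v v∈i ⟩
      w v                                          ≡⟨ ℕₚ.+-identityʳ (w v) ⟨
      w v + 0                                      ≡⟨ cong₂ _+_ (restrictTo-here i [] w v v∈i) (restrictTo-∉ {is} w v v∉is) ⟨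
      restrictTo (i ∷ []) w v + restrictTo is w v  ∎
      where
      v∉is : All (λ i′ → ¬ blockOfV v ≡ i′) is
      v∉is = subst (λ k → All (λ i′ → ¬ k ≡ i′) is) (sym v∈i) i∉is
    byBlock (no v∉i) = trans (restrictTo-there i is w v v∉i) (cong (_+ _) (sym (restrictTo-∉ w v (v∉i ∷ []))))

module _ {m Δ : ℕ} (Q : Fin m → Set) where

  liftT-inBlock : ∀ i j (t : Tgt m Δ) → Q i → TgtAll (Q ∘ blockOfV) (liftT i j t)
  liftT-inBlock i j (ty _) q = q
  liftT-inBlock i j (tz _) q = q
  liftT-inBlock i j zer    _ = tt
  liftT-inBlock i j one    _ = tt

  fresh-inBlock : ∀ (b c : Bool) (t : Tgt m (suc Δ)) → TgtAll (Q ∘ blockOfV) t →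
    TgtAll (Q ∘ blockOfV) (if b then t else if c then one else zer)
  fresh-inBlock true  _     t q = q
  fresh-inBlock false true  t _ = tt
  fresh-inBlock false false t _ = tt

  rho-inBlock : ∀ ch (x : XV m (suc Δ)) → Q (proj₁ x) → TgtAll (Q ∘ blockOfV) (rho m (suc Δ) ch x)
  rho-inBlock ch (i , zero , x) q with ch i
  ... | E1 c     = liftT-inBlock i zero (rho m Δ c x) q
  ... | E2 c     = tt
  ... | E3 x₁ x₂ = fresh-inBlock (does (x ≟X x₁)) (elemX x (lexPath m Δ x₁)) (ty (i , inj₂ tt)) q
  rho-inBlock ch (i , suc zero , x) q with ch i
  ... | E1 c     = tt
  ... | E2 c     = liftT-inBlock i (suc zero) (rho m Δ c x) q
  ... | E3 x₁ x₂ = fresh-inBlock (does (x ≟X x₂)) (elemX x (lexPath m Δ x₂)) (tz (i , inj₂ tt)) q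

module Series {m Δ : ℕ} (ch : Choice m (suc Δ)) where

  ρ : XV m (suc Δ) → Tgt m (suc Δ)
  ρ = rho m (suc Δ) ch

  restrictMon-inBlock : ∀ (Q : Fin m → Set) {p} → All (Q ∘ proj₁) p → ∀ {vs} → restrictMon ρ p ≡ just vs →
    All (Q ∘ blockOfV) vs
  restrictMon-inBlock Q p∈Q = restrictMon-All (Q ∘ blockOfV) ρ (All.map (λ {x} → rho-inBlock Q ch x) p∈Q)

  yields-++ : ∀ i is → All (λ i′ → ¬ i ≡ i′) is → ∀ w {a b} → InBlock i a → AvoidsBlock i b →
    yields ρ (restrictTo (i ∷ is) w) (a ++ b) ≡ yields ρ (restrictTo (i ∷ []) w) a ∧ yields ρ (restrictTo is w) b
  yields-++ i is i∉is w {a} {b} a∈i b∉i = Bool-≡ split join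
    where
    W Wa Wb : V m (suc Δ) → ℕ
    W  = restrictTo (i ∷ is) w
    Wa = restrictTo (i ∷ []) w
    Wb = restrictTo is w
    split : yields ρ W (a ++ b) ≡ true → yields ρ Wa a ∧ yields ρ Wb b ≡ true
    split e with yields-sound ρ W (a ++ b) e
    ... | vs , eq , has
        with zipWith-++-just⁻ (restrictMon ρ a) (restrictMon ρ b) (trans (sym (restrictMon-++ ρ a b)) eq)
    ... | va , vb , ea , eb , refl =
      let hasa , hasb = hasExponents-++ {va = va} {vb} (restrictTo-∷ i is i∉is w) disjoint has
      in ∧-intro (yields-complete ρ Wa a (va , ea , hasa)) (yields-complete ρ Wb b (vb , eb , hasb))
      where
      disjoint : ∀ v → (expo v va ≡ 0 × Wa v ≡ 0) ⊎ (expo v vb ≡ 0 × Wb v ≡ 0)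
      disjoint v = byBlock (blockOfV v ≟F i)
        where
        byBlock : Dec (blockOfV v ≡ i) → (expo v va ≡ 0 × Wa v ≡ 0) ⊎ (expo v vb ≡ 0 × Wb v ≡ 0)
        byBlock (yes refl) = inj₂ (expo-none v vb vb∌v , restrictTo-∉ w v i∉is)
          where
          vb∌v : All (λ u → ¬ u ≡ v) vb
          vb∌v = All.map (λ u∉i u≡v → u∉i (cong blockOfV u≡v)) (restrictMon-inBlock _ b∉i eb)
        byBlock (no v∉i) = inj₁ (expo-none v va va∌v , restrictTo-∉ w v (v∉i ∷ []))
          where
          va∌v : All (λ u → ¬ u ≡ v) va
          va∌v = All.map (λ u∈i u≡v → v∉i (trans (cong blockOfV (sym u≡v)) u∈i)) (restrictMon-inBlock _ a∈i ea)
    join : yields ρ Wa a ∧ yields ρ Wb b ≡ true → yields ρ W (a ++ b) ≡ true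
    join e with yields-sound ρ Wa a (∧-elimˡ e) | yields-sound ρ Wb b (∧-elimʳ {yields ρ Wa a} e)
    ... | va , ea , hasa | vb , eb , hasb = yields-complete ρ W (a ++ b)
      (va ++ vb , trans (restrictMon-++ ρ a b) (cong₂ (zipWith _++_) ea eb) ,
       hasExponents-++⁺ {va = va} {vb} (restrictTo-∷ i is i∉is w) hasa hasb)

  blockCoeff : (V m (suc Δ) → ℕ) → Fin m → ℕ
  blockCoeff w i = countᵇ (yields ρ (restrictTo (i ∷ []) w)) (block i)

  coeff-seriesOf : ∀ w is → Unique is →
    countᵇ (yields ρ (restrictTo is w)) (seriesOf is) ≡ product (map (blockCoeff w) is)
  coeff-seriesOf w [] [] rewrite yields-complete ρ (restrictTo [] w) [] ([] , refl , λ _ → refl) = refl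
  coeff-seriesOf w (i ∷ is) (i∉is ∷ unique) = begin
    countᵇ (yields ρ (restrictTo (i ∷ is) w)) (cartesianProductWith _++_ (block i) (seriesOf is))
      ≡⟨ countᵇ-cartesianProductWith _++_ _ (yields ρ (restrictTo (i ∷ []) w)) (yields ρ (restrictTo is w))
           (block i) (seriesOf is) (λ a∈ b∈ → yields-++ i is i∉is w (All.lookup (block-inBlock i) a∈)
                                                                 (All.lookup (seriesOf-avoidsBlock i is i∉is) b∈)) ⟩
    blockCoeff w i * countᵇ (yields ρ (restrictTo is w)) (seriesOf is)
      ≡⟨ cong (blockCoeff w i *_) (coeff-seriesOf w is unique) ⟩
    blockCoeff w i * product (map (blockCoeff w) is) ∎
    where open ≡-Reasoning

  coeff-suc : ∀ w → coeff m (suc Δ) ch w ≡ product (map (blockCoeff w) (allFin m))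
  coeff-suc w =
    trans (cong length (filterᵇ-cong {xs = seriesOf (allFin m)} (All.universal (yields-cong ρ (sym ∘ restrictTo-allFin w)) _)))
          (coeff-seriesOf w (allFin m) (Unique.allFin⁺ m))

module Block {m Δ : ℕ} (ch : Choice m (suc Δ)) (i : Fin m) where
  open Series ch using (ρ; blockCoeff)

  BlockTransversal : (V m (suc Δ) → ℕ) → Set
  BlockTransversal w = ∀ u → TransversalAt m (suc Δ) ch w (i , u)

  image-inBlock : ∀ s {y} {x} → ρ x ≡ tgtOn s y → proj₁ y ≡ proj₁ x
  image-inBlock ySide {x = x} e = subst (TgtAll _) e (rho-inBlock (_≡ proj₁ x) ch x refl)
  image-inBlock zSide {x = x} e = subst (TgtAll _) e (rho-inBlock (_≡ proj₁ x) ch x refl)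

  blockPart : (V m (suc Δ) → ℕ) → V m (suc Δ) → ℕ
  blockPart = restrictTo (i ∷ [])

  copyCoeff : (V m (suc Δ) → ℕ) → Fin 2 → ℕ
  copyCoeff w j = countᵇ (yields ρ (blockPart w)) (map (emb i j) (pathMons m Δ))

  blockCoeff-copies : ∀ w → blockCoeff w i ≡ copyCoeff w zero + copyCoeff w (suc zero)
  blockCoeff-copies w = countᵇ-++ _ (map (emb i zero) (pathMons m Δ)) _

  copyCoeff-killed : NonEmptyPaths m Δ → ∀ j → (∀ x → ρ (i , j , x) ≡ zer) → ∀ w → copyCoeff w j ≡ 0
  copyCoeff-killed nonEmpty j killed w = trans (countᵇ-map _ (emb i j) (pathMons m Δ))
    (cong length (filterᵇ-none (All.map (λ { {[]} p≢[] → ⊥-elim (p≢[] refl)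
                                           ; {x ∷ p} _ → yields-killed ρ (blockPart w) (emb i j (x ∷ p))
                                                           (restrictMon-killed ρ (i , j , x) (emb i j p) (killed x)) })
                                         nonEmpty)))

  data BlockView : V m (suc Δ) → Set where
    inBlock  : ∀ s u → BlockView (varOn s (i , u))
    offBlock : ∀ {v} → ¬ blockOfV v ≡ i → BlockView v

  blockView : ∀ v → BlockView v
  blockView (inj₁ (i′ , u)) with i′ ≟F i
  ... | yes refl = inBlock ySide u
  ... | no i′≢i  = offBlock i′≢i
  blockView (inj₂ (i′ , u)) with i′ ≟F i
  ... | yes refl = inBlock zSide u
  ... | no i′≢i  = offBlock i′≢i

  blockPart-inBlock : ∀ w s u → blockPart w (varOn s (i , u)) ≡ w (varOn s (i , u))
  blockPart-inBlock w ySide u = restrictTo-here i [] w (inj₁ (i , u)) refl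
  blockPart-inBlock w zSide u = restrictTo-here i [] w (inj₂ (i , u)) refl

  blockPart-offBlock : ∀ w {v} → ¬ blockOfV v ≡ i → blockPart w v ≡ 0
  blockPart-offBlock w {v} v∉i = restrictTo-∉ w v (v∉i ∷ [])

-- Blocks with choice E1 or E2

module _ {m Δ : ℕ} (i : Fin m) (j : Fin 2) where

  liftT-tgtOn : ∀ s (y : YV m Δ) → liftT i j (tgtOn s y) ≡ tgtOn s (i , inj₁ (j , y))
  liftT-tgtOn ySide y = refl
  liftT-tgtOn zSide y = refl

  liftT-tgtOn⁻ : ∀ s (t : Tgt m Δ) {u} → liftT i j t ≡ tgtOn s (i , u) → ∃ λ y → t ≡ tgtOn s y × u ≡ inj₁ (j , y)
  liftT-tgtOn⁻ ySide (ty y) refl = y , refl , refl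
  liftT-tgtOn⁻ zSide (tz z) refl = z , refl , refl

  liftV-varOn : ∀ s (y : YV m Δ) → liftV i j (varOn s y) ≡ varOn s (i , inj₁ (j , y))
  liftV-varOn ySide y = refl
  liftV-varOn zSide y = refl

  expo-liftV : ∀ (u : V m Δ) vs → expo (liftV i j u) (map (liftV i j) vs) ≡ expo u vs
  expo-liftV u vs = trans (countᵇ-map _ (liftV i j) vs)
    (cong length (filterᵇ-cong (All.universal (λ a → does-injective _≟V_ (_≟V_ {m} {suc Δ}) (liftV-injective i j) a u) vs)))

  expo-unlifted : ∀ (v : V m (suc Δ)) vs → (∀ a → ¬ liftV i j a ≡ v) → expo v (map (liftV i j) vs) ≡ 0
  expo-unlifted v vs unlifted = expo-none v (map (liftV i j) vs) (map⁺ (All.universal unlifted vs))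

zer≢tgtOn : ∀ {m Δ} s {y : YV m Δ} → ¬ zer ≡ tgtOn s y
zer≢tgtOn ySide ()
zer≢tgtOn zSide ()

module Active {m Δ : ℕ} (ch : Choice m (suc Δ)) (i : Fin m) (j : Fin 2) (c : Choice m Δ)
    (active : ∀ x → rho m (suc Δ) ch (i , j , x) ≡ liftT i j (rho m Δ c x))
    (killed : ∀ j′ x → ¬ j′ ≡ j → rho m (suc Δ) ch (i , j′ , x) ≡ zer) where
  open Series ch using (ρ; blockCoeff)
  open Block ch i

  OffCopy : (Fin 2 × YV m Δ) ⊎ ⊤ → Set
  OffCopy u = ∀ y → ¬ u ≡ inj₁ (j , y)

  VanishesOffCopy : (V m (suc Δ) → ℕ) → Set
  VanishesOffCopy w = ∀ s u → OffCopy u → w (varOn s (i , u)) ≡ 0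

  copyOf : (V m (suc Δ) → ℕ) → V m Δ → ℕ
  copyOf w = w ∘ liftV i j

  image⁻ : ∀ s {u} → InImage m (suc Δ) ch s (i , u) → ∃ λ y → u ≡ inj₁ (j , y) × InImage m Δ c s y
  image⁻ s ((i′ , j′ , x) , e) with image-inBlock s {x = i′ , j′ , x} e
  ... | refl with j′ ≟F j
  ... | yes refl = let y , e′ , u≡ = liftT-tgtOn⁻ i j s (rho m Δ c x) (trans (sym (active x)) e) in y , u≡ , x , e′
  ... | no j′≢j  = ⊥-elim (zer≢tgtOn s (trans (sym (killed j′ x j′≢j)) e))

  image⁺ : ∀ s {y} → InImage m Δ c s y → InImage m (suc Δ) ch s (i , inj₁ (j , y))
  image⁺ s {y} (x , e) = (i , j , x) , trans (active x) (trans (cong (liftT i j) e) (liftT-tgtOn i j s y))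

  unlifted-offCopy : ∀ s {u} → OffCopy u → ∀ a → ¬ liftV i j a ≡ varOn s (i , u)
  unlifted-offCopy ySide off (inj₁ y) refl = off y refl
  unlifted-offCopy zSide off (inj₂ z) refl = off z refl

  unlifted-offBlock : ∀ {v : V m (suc Δ)} → ¬ blockOfV v ≡ i → ∀ (a : V m Δ) → ¬ liftV i j a ≡ v
  unlifted-offBlock v∉i (inj₁ _) refl = v∉i refl
  unlifted-offBlock v∉i (inj₂ _) refl = v∉i refl

  restrictMon-active : ∀ p → restrictMon ρ (emb i j p) ≡ mapᴹ (map (liftV i j)) (restrictMon (rho m Δ c) p)
  restrictMon-active = restrictMon-emb i j ρ (rho m Δ c) active

  yields⁻ : ∀ w p → Yields ρ (blockPart w) (emb i j p) → Yields (rho m Δ c) (copyOf w) p × VanishesOffCopy w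
  yields⁻ w p (vs , e , has)
      with mapᴹ-just⁻ (map (liftV i j)) (restrictMon (rho m Δ c) p) (trans (sym (restrictMon-active p)) e)
  ... | vs₀ , e₀ , refl =
    (vs₀ , e₀ , λ u → trans (sym (expo-liftV i j u vs₀)) (trans (has (liftV i j u)) (inCopy u))) , vanishes
    where
    inCopy : ∀ u → blockPart w (liftV i j u) ≡ w (liftV i j u)
    inCopy (inj₁ y) = blockPart-inBlock w ySide (inj₁ (j , y))
    inCopy (inj₂ z) = blockPart-inBlock w zSide (inj₁ (j , z))
    vanishes : VanishesOffCopy w
    vanishes s u off = begin
      w (varOn s (i , u))                            ≡⟨ blockPart-inBlock w s u ⟨
      blockPart w (varOn s (i , u))                  ≡⟨ has (varOn s (i , u)) ⟨
      expo (varOn s (i , u)) (map (liftV i j) vs₀)   ≡⟨ expo-unlifted i j _ vs₀ (unlifted-offCopy s off) ⟩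
      0                                              ∎
      where open ≡-Reasoning

  yields⁺ : ∀ w p → Yields (rho m Δ c) (copyOf w) p → VanishesOffCopy w → Yields ρ (blockPart w) (emb i j p)
  yields⁺ w p (vs₀ , e₀ , has₀) vanishes =
    map (liftV i j) vs₀ , trans (restrictMon-active p) (cong (mapᴹ (map (liftV i j))) e₀) , λ v → has (blockView v)
    where
    offCopy : ∀ s u → OffCopy u → expo (varOn s (i , u)) (map (liftV i j) vs₀) ≡ blockPart w (varOn s (i , u))
    offCopy s u off = trans (expo-unlifted i j _ vs₀ (unlifted-offCopy s off))
                            (sym (trans (blockPart-inBlock w s u) (vanishes s u off)))
    has : ∀ {v} → BlockView v → expo v (map (liftV i j) vs₀) ≡ blockPart w v
    has (inBlock s (inj₁ (j′ , y))) with j′ ≟F j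
    ... | yes refl = begin
      expo (varOn s (i , inj₁ (j , y))) (map (liftV i j) vs₀)  ≡⟨ cong (λ v → expo v lifted) (liftV-varOn i j s y) ⟨
      expo (liftV i j (varOn s y)) (map (liftV i j) vs₀)       ≡⟨ expo-liftV i j (varOn s y) vs₀ ⟩
      expo (varOn s y) vs₀                                     ≡⟨ has₀ (varOn s y) ⟩
      w (liftV i j (varOn s y))                                ≡⟨ cong w (liftV-varOn i j s y) ⟩
      w (varOn s (i , inj₁ (j , y)))                           ≡⟨ blockPart-inBlock w s (inj₁ (j , y)) ⟨
      blockPart w (varOn s (i , inj₁ (j , y)))                 ∎
      where
      open ≡-Reasoning
      lifted : List (V m (suc Δ))
      lifted = map (liftV i j) vs₀
    ... | no j′≢j  = offCopy s (inj₁ (j′ , y)) (λ y′ e → j′≢j (cong proj₁ (inj₁-injective e)))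
    has (inBlock s (inj₂ tt)) = offCopy s (inj₂ tt) (λ y ())
    has (offBlock {v} v∉i) = trans (expo-unlifted i j v vs₀ (unlifted-offBlock v∉i)) (sym (blockPart-offBlock w v∉i))

  copyCoeff-active : ∀ w → VanishesOffCopy w → copyCoeff w j ≡ coeff m Δ c (copyOf w)
  copyCoeff-active w vanishes =
    trans (countᵇ-map _ (emb i j) (pathMons m Δ)) (cong length (filterᵇ-cong (All.universal sameYield (pathMons m Δ))))
    where
    sameYield : ∀ p → yields ρ (blockPart w) (emb i j p) ≡ yields (rho m Δ c) (copyOf w) p
    sameYield p = Bool-≡
      (yields-complete (rho m Δ c) (copyOf w) p ∘ proj₁ ∘ yields⁻ w p ∘ yields-sound ρ (blockPart w) (emb i j p))
      (λ e → yields-complete ρ (blockPart w) (emb i j p) (yields⁺ w p (yields-sound (rho m Δ c) (copyOf w) p e) vanishes))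

  copyCoeff≢0⇒vanishes : ∀ w → ¬ copyCoeff w j ≡ 0 → VanishesOffCopy w
  copyCoeff≢0⇒vanishes w ≢0 =
    let p , e = countᵇ-witness _ (pathMons m Δ) (≢0 ∘ trans (countᵇ-map _ (emb i j) (pathMons m Δ)))
    in proj₂ (yields⁻ w p (yields-sound ρ (blockPart w) (emb i j p) e))

  inCopy : ∀ y → InImage m (suc Δ) ch ySide (i , inj₁ (j , y)) → InImage m Δ c ySide y
  inCopy y img with image⁻ ySide img
  ... | _ , refl , img′ = img′

  offCopy-∉image : ∀ s {u} → OffCopy u → ¬ InImage m (suc Δ) ch s (i , u)
  offCopy-∉image s off img = let y , u≡ , _ = image⁻ s img in off y u≡

  transversal⁻ : ∀ w → BlockTransversal w → IsTransversal m Δ c (copyOf w) × VanishesOffCopy w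
  transversal⁻ w bt = (λ y → proj₁ (bt (inj₁ (j , y))) ∘ image⁺ ySide , λ ∉ → proj₂ (bt (inj₁ (j , y))) (∉ ∘ inCopy y)) ,
                      vanishes
    where
    vanishes : VanishesOffCopy w
    vanishes ySide u off = proj₁ (proj₂ (bt u) (offCopy-∉image ySide off))
    vanishes zSide u off = proj₂ (proj₂ (bt u) (offCopy-∉image ySide off))

  transversal⁺ : ∀ w → IsTransversal m Δ c (copyOf w) → VanishesOffCopy w → BlockTransversal w
  transversal⁺ w tr vanishes (inj₁ (j′ , y)) with j′ ≟F j
  ... | yes refl = proj₁ (tr y) ∘ inCopy y , λ ∉ → proj₂ (tr y) (∉ ∘ image⁺ ySide)
  ... | no j′≢j  = offCopy (λ y′ e → j′≢j (cong proj₁ (inj₁-injective e)))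
    where
    offCopy : OffCopy (inj₁ (j′ , y)) → TransversalAt m (suc Δ) ch w (i , inj₁ (j′ , y))
    offCopy off = ⊥-elim ∘ offCopy-∉image ySide off , λ _ → vanishes ySide _ off , vanishes zSide _ off
  transversal⁺ w tr vanishes (inj₂ tt) =
    ⊥-elim ∘ offCopy-∉image ySide off , λ _ → vanishes ySide _ off , vanishes zSide _ off
    where
    off : OffCopy (inj₂ tt)
    off y ()

  copyCoeff-indicator : ∀ w → Indicator (coeff m Δ c (copyOf w)) (IsTransversal m Δ c (copyOf w)) →
    Indicator (copyCoeff w j) (BlockTransversal w)
  copyCoeff-indicator w ih with copyCoeff w j Data.Nat.≟ 0
  ... | yes ≡0 = inj₂ (≡0 , λ bt → let tr , vanishes = transversal⁻ w bt in
                         ℕₚ.0≢1+n (trans (sym ≡0) (trans (copyCoeff-active w vanishes) (Indicator-⇒≡1 ih tr))))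
  ... | no ≢0  = let vanishes = copyCoeff≢0⇒vanishes w ≢0 in
    Indicator-resp (sym (copyCoeff-active w vanishes)) (λ tr → transversal⁺ w tr vanishes) (proj₁ ∘ transversal⁻ w) ih

  blockCoeff-indicator : NonEmptyPaths m Δ → ∀ w →
    Indicator (coeff m Δ c (copyOf w)) (IsTransversal m Δ c (copyOf w)) → Indicator (blockCoeff w i) (BlockTransversal w)
  blockCoeff-indicator nonEmpty w ih =
    Indicator-resp (sym (trans (blockCoeff-copies w) (onlyCopy j dead))) (λ bt → bt) (λ bt → bt) (copyCoeff-indicator w ih)
    where
    dead : ∀ j′ → ¬ j′ ≡ j → copyCoeff w j′ ≡ 0
    dead j′ j′≢j = copyCoeff-killed nonEmpty j′ (λ x → killed j′ x j′≢j) w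
    onlyCopy : ∀ j → (∀ j′ → ¬ j′ ≡ j → copyCoeff w j′ ≡ 0) →
      copyCoeff w zero + copyCoeff w (suc zero) ≡ copyCoeff w j
    onlyCopy zero       others = trans (cong (copyCoeff w zero +_) (others (suc zero) (λ ()))) (ℕₚ.+-identityʳ _)
    onlyCopy (suc zero) others = cong (_+ copyCoeff w (suc zero)) (others zero (λ ()))

-- Blocks with choice E3

module Fresh {m Δ : ℕ} (ch : Choice m (suc Δ)) (i : Fin m) (x₁ x₂ : XV m Δ) (chosen : ch i ≡ E3 x₁ x₂)
    (onlyPath : ∀ x → OnlyPathOn (lexPath m Δ x)) where
  open Series ch using (ρ; blockCoeff)
  open Block ch i

  copyOn : Side → Fin 2
  copyOn ySide = zero
  copyOn zSide = suc zero

  edgeOn : Side → XV m Δ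
  edgeOn ySide = x₁
  edgeOn zSide = x₂

  pathOn : Side → List (XV m Δ)
  pathOn s = lexPath m Δ (edgeOn s)

  fresh : YV m (suc Δ)
  fresh = i , inj₂ tt

  rho-fresh : ∀ s x → ρ (i , copyOn s , x) ≡
    (if does (x ≟X edgeOn s) then tgtOn s fresh else if elemX x (pathOn s) then one else zer)
  rho-fresh ySide x rewrite chosen = refl
  rho-fresh zSide x rewrite chosen = refl

  edge∈path : ∀ s → elemX (edgeOn s) (pathOn s) ≡ true
  edge∈path s =
    occ≢0⇒elemX (edgeOn s) (pathOn s) (λ occ≡0 → ℕₚ.0≢1+n (trans (sym occ≡0) (occ-lexPath m Δ (edgeOn s))))


  offPath : ∀ s x → ¬ x ≡ edgeOn s → elemX x (pathOn s) ≡ false → ρ (i , copyOn s , x) ≡ zer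
  offPath s x x≢e x∉ rewrite rho-fresh s x | dec-false (x ≟X edgeOn s) x≢e | x∉ = refl

  onPath : ∀ s x → ¬ ρ (i , copyOn s , x) ≡ zer → elemX x (pathOn s) ≡ true
  onPath s x ≢zer = byEdge (x ≟X edgeOn s)
    where
    byEdge : Dec (x ≡ edgeOn s) → elemX x (pathOn s) ≡ true
    byEdge (yes refl) = edge∈path s
    byEdge (no x≢e) with elemX x (pathOn s) in x∈
    ... | true  = refl
    ... | false = ⊥-elim (≢zer (offPath s x x≢e x∈))

  surviving⇒liesOn : ∀ s p {vs} → restrictMon ρ (emb i (copyOn s) p) ≡ just vs → liesOn (pathOn s) p ≡ true
  surviving⇒liesOn s []      _ = refl
  surviving⇒liesOn s (x ∷ p) e
      with consTgt-just⁻ (ρ (i , copyOn s , x)) _ (trans (sym (restrictMon-∷ ρ (i , copyOn s , x) (emb i (copyOn s) p))) e)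
  ... | _ , e′ , ≢zer = ∧-intro (onPath s x ≢zer) (surviving⇒liesOn s p e′)

  restrictMon-onPath : ∀ s p → liesOn (pathOn s) p ≡ true →
    restrictMon ρ (emb i (copyOn s) p) ≡ just (replicate (occ (edgeOn s) p) (varOn s fresh))
  restrictMon-onPath s []      _  = refl
  restrictMon-onPath s (x ∷ p) on
    rewrite restrictMon-∷ ρ (i , copyOn s , x) (emb i (copyOn s) p)
          | restrictMon-onPath s p (∧-elimʳ {elemX x (pathOn s)} on)
          | rho-fresh s x
    with x ≟X edgeOn s
  ... | yes refl = consTgt-fresh s
    where
    consTgt-fresh : ∀ s {vs} → consTgt (tgtOn s fresh) (just vs) ≡ just (varOn s fresh ∷ vs)
    consTgt-fresh ySide = refl
    consTgt-fresh zSide = refl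
  ... | no x≢e   =
    cong (λ b → consTgt (if b then one else zer) (just (replicate (occ (edgeOn s) p) (varOn s fresh)))) (∧-elimˡ on)

  restrictMon-pathOn : ∀ s → restrictMon ρ (emb i (copyOn s) (pathOn s)) ≡ just (varOn s fresh ∷ [])
  restrictMon-pathOn s = trans (restrictMon-onPath s (pathOn s) (liesOn-self (pathOn s)))
                               (cong (λ k → just (replicate k (varOn s fresh))) (occ-lexPath m Δ (edgeOn s)))

  copyCoeff-fresh : ∀ w s → copyCoeff w (copyOn s) ≡ bit (yields ρ (blockPart w) (emb i (copyOn s) (pathOn s)))
  copyCoeff-fresh w s = begin
    countᵇ (yields ρ (blockPart w)) (map (emb i (copyOn s)) (pathMons m Δ))
      ≡⟨ countᵇ-map _ (emb i (copyOn s)) (pathMons m Δ) ⟩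
    countᵇ survives (pathMons m Δ)
      ≡⟨ cong length (filterᵇ-weaken survives (liesOn (pathOn s)) (pathMons m Δ) survives⇒liesOn) ⟩
    countᵇ survives (filterᵇ (liesOn (pathOn s)) (pathMons m Δ))
      ≡⟨ cong (countᵇ survives) (onlyPath (edgeOn s)) ⟩
    countᵇ survives (pathOn s ∷ [])
      ≡⟨ countᵇ-single survives (pathOn s) ⟩
    bit (survives (pathOn s)) ∎
    where
    open ≡-Reasoning
    survives : List (XV m Δ) → Bool
    survives = yields ρ (blockPart w) ∘ emb i (copyOn s)
    survives⇒liesOn : ∀ p → survives p ≡ true → liesOn (pathOn s) p ≡ true
    survives⇒liesOn p e = surviving⇒liesOn s p (proj₁ (proj₂ (yields-sound ρ (blockPart w) (emb i (copyOn s) p) e)))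

  CopiesVanish : (V m (suc Δ) → ℕ) → Set
  CopiesVanish w = ∀ s j y → w (varOn s (i , inj₁ (j , y))) ≡ 0

  PicksFresh : Side → (V m (suc Δ) → ℕ) → Set
  PicksFresh s w = w (varOn s fresh) ≡ 1 × w (varOn (opposite s) fresh) ≡ 0 × CopiesVanish w

  expo-singleton : ∀ (u v : V m (suc Δ)) → expo v (u ∷ []) ≡ bit (does (u ≟V v))
  expo-singleton u v = countᵇ-single (λ w → does (w ≟V v)) u

  expo-self : ∀ (v : V m (suc Δ)) → expo v (v ∷ []) ≡ 1
  expo-self v = trans (expo-singleton v v) (cong bit (dec-true (v ≟V v) refl))

  expo-other : ∀ (u v : V m (suc Δ)) → ¬ u ≡ v → expo v (u ∷ []) ≡ 0
  expo-other u v u≢v = trans (expo-singleton u v) (cong bit (dec-false (u ≟V v) u≢v))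

  fresh≢copy : ∀ s s′ {j y} → ¬ varOn s fresh ≡ varOn s′ (i , inj₁ (j , y))
  fresh≢copy ySide ySide ()
  fresh≢copy zSide zSide ()

  fresh≢opposite : ∀ s → ¬ varOn s fresh ≡ varOn (opposite s) fresh
  fresh≢opposite ySide ()
  fresh≢opposite zSide ()

  other-fresh : ∀ s s′ → ¬ varOn s fresh ≡ varOn s′ fresh → s′ ≡ opposite s
  other-fresh ySide ySide ≢ = ⊥-elim (≢ refl)
  other-fresh ySide zSide _ = refl
  other-fresh zSide ySide _ = refl
  other-fresh zSide zSide ≢ = ⊥-elim (≢ refl)

  picksFresh⁻ : ∀ s w → HasExponents (varOn s fresh ∷ []) (blockPart w) → PicksFresh s w
  picksFresh⁻ s w has = at s (inj₂ tt) 1 (expo-self (varOn s fresh))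
                      , at (opposite s) (inj₂ tt) 0 (expo-other _ _ (fresh≢opposite s))
                      , λ s′ j y → at s′ (inj₁ (j , y)) 0 (expo-other _ _ (fresh≢copy s s′))
    where
    at : ∀ s′ u k → expo (varOn s′ (i , u)) (varOn s fresh ∷ []) ≡ k → w (varOn s′ (i , u)) ≡ k
    at s′ u k e = trans (sym (blockPart-inBlock w s′ u)) (trans (sym (has _)) e)

  picksFresh⁺ : ∀ s w → PicksFresh s w → HasExponents (varOn s fresh ∷ []) (blockPart w)
  picksFresh⁺ s w (≡1 , opposite≡0 , copies≡0) v = has (blockView v)
    where
    has : ∀ {v} → BlockView v → expo v (varOn s fresh ∷ []) ≡ blockPart w v
    has (inBlock s′ u) = byVar (varOn s fresh ≟V varOn s′ (i , u))
      where
      vanishes : ∀ u → ¬ varOn s fresh ≡ varOn s′ (i , u) → w (varOn s′ (i , u)) ≡ 0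
      vanishes (inj₁ (j , y)) _ = copies≡0 s′ j y
      vanishes (inj₂ tt)      ≢ rewrite other-fresh s s′ ≢ = opposite≡0
      byVar : Dec (varOn s fresh ≡ varOn s′ (i , u)) →
        expo (varOn s′ (i , u)) (varOn s fresh ∷ []) ≡ blockPart w (varOn s′ (i , u))
      byVar (yes e) = trans (subst (λ v → expo v (varOn s fresh ∷ []) ≡ 1) e (expo-self (varOn s fresh)))
                            (sym (trans (blockPart-inBlock w s′ u) (subst (λ v → w v ≡ 1) e ≡1)))
      byVar (no ≢)  = trans (expo-other _ _ ≢) (sym (trans (blockPart-inBlock w s′ u) (vanishes u ≢)))
    has (offBlock {v} v∉i) =
      trans (expo-other (varOn s fresh) v (λ e → v∉i (trans (sym (cong blockOfV e)) (freshInBlock s))))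
            (sym (blockPart-offBlock w v∉i))
      where
      freshInBlock : ∀ s → blockOfV (varOn s fresh) ≡ i
      freshInBlock ySide = refl
      freshInBlock zSide = refl

  targets : ∀ s x → ρ (i , copyOn s , x) ≡ zer ⊎ ρ (i , copyOn s , x) ≡ one ⊎ ρ (i , copyOn s , x) ≡ tgtOn s fresh
  targets s x rewrite rho-fresh s x with does (x ≟X edgeOn s) | elemX x (pathOn s)
  ... | true  | _     = inj₂ (inj₂ refl)
  ... | false | true  = inj₂ (inj₁ refl)
  ... | false | false = inj₁ refl

  onlyFresh : ∀ s s′ {t u} → t ≡ zer ⊎ t ≡ one ⊎ t ≡ tgtOn s′ fresh → t ≡ tgtOn s (i , u) → u ≡ inj₂ tt
  onlyFresh ySide _     (inj₁ refl)        ()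
  onlyFresh zSide _     (inj₁ refl)        ()
  onlyFresh ySide _     (inj₂ (inj₁ refl)) ()
  onlyFresh zSide _     (inj₂ (inj₁ refl)) ()
  onlyFresh ySide ySide (inj₂ (inj₂ refl)) refl = refl
  onlyFresh zSide zSide (inj₂ (inj₂ refl)) refl = refl
  onlyFresh ySide zSide (inj₂ (inj₂ refl)) ()
  onlyFresh zSide ySide (inj₂ (inj₂ refl)) ()

  image-fresh⁻ : ∀ s {u} → InImage m (suc Δ) ch s (i , u) → u ≡ inj₂ tt
  image-fresh⁻ s ((i′ , zero , x) , e) with image-inBlock s {x = i′ , zero , x} e
  ... | refl = onlyFresh s ySide (targets ySide x) e
  image-fresh⁻ s ((i′ , suc zero , x) , e) with image-inBlock s {x = i′ , suc zero , x} e
  ... | refl = onlyFresh s zSide (targets zSide x) e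

  image-fresh⁺ : ∀ s → InImage m (suc Δ) ch s fresh
  image-fresh⁺ s = (i , copyOn s , edgeOn s) ,
    trans (rho-fresh s (edgeOn s))
          (cong (λ b → if b then tgtOn s fresh else if elemX (edgeOn s) (pathOn s) then one else zer)
                (dec-true (edgeOn s ≟X edgeOn s) refl))

  copy∉image : ∀ s {j y} → ¬ InImage m (suc Δ) ch s (i , inj₁ (j , y))
  copy∉image s img with image-fresh⁻ s img
  ... | ()

  copiesVanish : ∀ w → BlockTransversal w → CopiesVanish w
  copiesVanish w bt ySide j y = proj₁ (proj₂ (bt (inj₁ (j , y))) (copy∉image ySide))
  copiesVanish w bt zSide j y = proj₂ (proj₂ (bt (inj₁ (j , y))) (copy∉image ySide))

  transversal⁻ : ∀ w → BlockTransversal w → PicksFresh ySide w ⊎ PicksFresh zSide w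
  transversal⁻ w bt with +≡1⇒ (w (inj₁ fresh)) (w (inj₂ fresh)) (proj₁ (bt (inj₂ tt)) (image-fresh⁺ ySide))
  ... | inj₁ (y≡1 , z≡0) = inj₁ (y≡1 , z≡0 , copiesVanish w bt)
  ... | inj₂ (y≡0 , z≡1) = inj₂ (z≡1 , y≡0 , copiesVanish w bt)

  transversal⁺ : ∀ w → PicksFresh ySide w ⊎ PicksFresh zSide w → BlockTransversal w
  transversal⁺ w picks (inj₁ (j , y)) =
    ⊥-elim ∘ copy∉image ySide , λ _ → copies picks ySide j y , copies picks zSide j y
    where
    copies : PicksFresh ySide w ⊎ PicksFresh zSide w → CopiesVanish w
    copies (inj₁ (_ , _ , vanish)) = vanish
    copies (inj₂ (_ , _ , vanish)) = vanish
  transversal⁺ w (inj₁ (y≡1 , z≡0 , _)) (inj₂ tt) = (λ _ → cong₂ _+_ y≡1 z≡0) , λ ∉ → ⊥-elim (∉ (image-fresh⁺ ySide))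
  transversal⁺ w (inj₂ (z≡1 , y≡0 , _)) (inj₂ tt) = (λ _ → cong₂ _+_ y≡0 z≡1) , λ ∉ → ⊥-elim (∉ (image-fresh⁺ ySide))

  pathOn-indicator : ∀ w s → Indicator (copyCoeff w (copyOn s)) (PicksFresh s w)
  pathOn-indicator w s = Indicator-resp (sym (copyCoeff-fresh w s)) picks⁻ picks⁺ (Indicator-bit _)
    where
    picks⁻ : yields ρ (blockPart w) (emb i (copyOn s) (pathOn s)) ≡ true → PicksFresh s w
    picks⁻ e with yields-sound ρ (blockPart w) (emb i (copyOn s) (pathOn s)) e
    ... | vs , e′ , has with trans (sym (restrictMon-pathOn s)) e′
    ... | refl = picksFresh⁻ s w has
    picks⁺ : PicksFresh s w → yields ρ (blockPart w) (emb i (copyOn s) (pathOn s)) ≡ true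
    picks⁺ p = yields-complete ρ (blockPart w) (emb i (copyOn s) (pathOn s))
                               (varOn s fresh ∷ [] , restrictMon-pathOn s , picksFresh⁺ s w p)

  blockCoeff-indicator : ∀ w → Indicator (blockCoeff w i) (BlockTransversal w)
  blockCoeff-indicator w =
    Indicator-resp (sym (blockCoeff-copies w)) (transversal⁺ w) (transversal⁻ w)
      (Indicator-+ (pathOn-indicator w ySide) (pathOn-indicator w zSide)
                   (λ ((y≡1 , _) , (_ , y≡0 , _)) → ℕₚ.0≢1+n (trans (sym y≡0) y≡1)))


-- P^(Δ)|ρ = ∏_{k ∈ Ỹ} (y_k + z_k)

module _ {m Δ : ℕ} (ch : Choice m (suc Δ)) (i : Fin m) where

  rho-E1 : ∀ {c} → ch i ≡ E1 c → ∀ x → rho m (suc Δ) ch (i , zero , x) ≡ liftT i zero (rho m Δ c x)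
  rho-E1 chosen x rewrite chosen = refl

  rho-E1-killed : ∀ {c} → ch i ≡ E1 c → ∀ j x → ¬ j ≡ zero → rho m (suc Δ) ch (i , j , x) ≡ zer
  rho-E1-killed chosen zero       x j≢0 = ⊥-elim (j≢0 refl)
  rho-E1-killed chosen (suc zero) x _   rewrite chosen = refl

  rho-E2 : ∀ {c} → ch i ≡ E2 c → ∀ x → rho m (suc Δ) ch (i , suc zero , x) ≡ liftT i (suc zero) (rho m Δ c x)
  rho-E2 chosen x rewrite chosen = refl

  rho-E2-killed : ∀ {c} → ch i ≡ E2 c → ∀ j x → ¬ j ≡ suc zero → rho m (suc Δ) ch (i , j , x) ≡ zer
  rho-E2-killed chosen zero       x _   rewrite chosen = refl
  rho-E2-killed chosen (suc zero) x j≢1 = ⊥-elim (j≢1 refl)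

coeff-indicator : ∀ m Δ (ch : Choice (suc m) Δ) w → Indicator (coeff (suc m) Δ ch w) (IsTransversal (suc m) Δ ch w)
coeff-indicator m zero    tt w = Level0.coeff-indicator (suc m) w
coeff-indicator m (suc Δ) ch w =
  Indicator-resp (sym (Series.coeff-suc ch w))
    (λ all (i , u) → All.lookup all (∈-allFin i) u) (λ tr → All.tabulate (λ {i} _ u → tr (i , u)))
    (Indicator-product blockIndicator (allFin (suc m)))
  where
  open Series ch using (blockCoeff)
  blockIndicator : ∀ i → Indicator (blockCoeff w i) (Block.BlockTransversal ch i w)
  blockIndicator i with ch i in chosen
  ... | E1 c     = Active.blockCoeff-indicator ch i zero c (rho-E1 ch i chosen) (rho-E1-killed ch i chosen)
                     (nonEmptyPaths m Δ) w (coeff-indicator m Δ c _)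
  ... | E2 c     = Active.blockCoeff-indicator ch i (suc zero) c (rho-E2 ch i chosen) (rho-E2-killed ch i chosen)
                     (nonEmptyPaths m Δ) w (coeff-indicator m Δ c _)
  ... | E3 x₁ x₂ = Fresh.blockCoeff-indicator ch i x₁ x₂ chosen (onlyPathOn-lexPath m Δ) w

inImage-opposite : ∀ m Δ (ch : Choice (suc m) Δ) s {y} → InImage (suc m) Δ ch s y → InImage (suc m) Δ ch (opposite s) y
inImage-opposite m zero    tt s {y} _ = Level0.inImage (suc m) (opposite s) y
inImage-opposite m (suc Δ) ch s {i , u} img with ch i in chosen
... | E1 c with Active.image⁻ ch i zero c (rho-E1 ch i chosen) (rho-E1-killed ch i chosen) s img
...   | _ , refl , img′ = Active.image⁺ ch i zero c (rho-E1 ch i chosen) (rho-E1-killed ch i chosen) (opposite s)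
                            (inImage-opposite m Δ c s img′)
inImage-opposite m (suc Δ) ch s {i , u} img | E2 c
  with Active.image⁻ ch i (suc zero) c (rho-E2 ch i chosen) (rho-E2-killed ch i chosen) s img
...   | _ , refl , img′ = Active.image⁺ ch i (suc zero) c (rho-E2 ch i chosen) (rho-E2-killed ch i chosen) (opposite s)
                            (inImage-opposite m Δ c s img′)
inImage-opposite m (suc Δ) ch s {i , u} img | E3 x₁ x₂
  with Fresh.image-fresh⁻ ch i x₁ x₂ chosen (onlyPathOn-lexPath m Δ) s img
...   | refl = Fresh.image-fresh⁺ ch i x₁ x₂ chosen (onlyPathOn-lexPath m Δ) (opposite s)

-- The coefficient matrix

module _ {m Δ : ℕ} where

  isTgt : Side → YV m Δ → Tgt m Δ → Bool
  isTgt ySide = isTy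
  isTgt zSide = isTz

  isTgt-sound : ∀ s y t → isTgt s y t ≡ true → t ≡ tgtOn s y
  isTgt-sound ySide y (ty y′) e = cong ty (sym (does-sound (y ≟Y y′) e))
  isTgt-sound zSide y (tz y′) e = cong tz (sym (does-sound (y ≟Y y′) e))

  isTgt-complete : ∀ s y → isTgt s y (tgtOn s y) ≡ true
  isTgt-complete ySide y = dec-true (y ≟Y y) refl
  isTgt-complete zSide y = dec-true (y ≟Y y) refl

inImageᵇ : ∀ m Δ → Choice m Δ → Side → YV m Δ → Bool
inImageᵇ m Δ ch s y = any (λ x → isTgt s y (rho m Δ ch x)) (allX m Δ)

module _ (m Δ : ℕ) (ch : Choice m Δ) where

  inImageᵇ-sound : ∀ s y → inImageᵇ m Δ ch s y ≡ true → InImage m Δ ch s y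
  inImageᵇ-sound s y e = let x , hit = any-sound _ (allX m Δ) e in x , isTgt-sound s y _ hit

  inImageᵇ-complete : ∀ s y → InImage m Δ ch s y → inImageᵇ m Δ ch s y ≡ true
  inImageᵇ-complete s y (x , e) =
    any-complete _ (allX-complete m Δ x) (subst (λ t → isTgt s y t ≡ true) (sym e) (isTgt-complete s y))

  Ytil-unique : Unique (Ytil m Δ ch)
  Ytil-unique = Unique.filter⁺ (T? ∘ inImageᵇ m Δ ch ySide) (allY-unique m Δ)

  ∈Ytil⇒inImage : ∀ {y} → y ∈ Ytil m Δ ch → InImage m Δ ch ySide y
  ∈Ytil⇒inImage {y} y∈ =
    inImageᵇ-sound ySide y (T⇒≡true (proj₂ (∈-filter⁻ (T? ∘ inImageᵇ m Δ ch ySide) {xs = allY m Δ} y∈)))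

  inImage⇒∈Ytil : ∀ {y} → InImage m Δ ch ySide y → y ∈ Ytil m Δ ch
  inImage⇒∈Ytil {y} img = ∈-filter⁺ (T? ∘ inImageᵇ m Δ ch ySide) (allY-complete m Δ y)
                                    (≡true⇒T (inImageᵇ-complete ySide y img))

Ytil≡Ztil : ∀ m Δ (ch : Choice (suc m) Δ) → Ytil (suc m) Δ ch ≡ Ztil (suc m) Δ ch
Ytil≡Ztil m Δ ch = filterᵇ-cong (All.universal (λ y → Bool-≡
  (inImageᵇ-complete (suc m) Δ ch zSide y ∘ inImage-opposite m Δ ch ySide ∘ inImageᵇ-sound (suc m) Δ ch ySide y)
  (inImageᵇ-complete (suc m) Δ ch ySide y ∘ inImage-opposite m Δ ch zSide ∘ inImageᵇ-sound (suc m) Δ ch zSide y))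
  (allY (suc m) Δ))

targetExponents : ∀ m Δ ch → Vec Bool (length (Ytil m Δ ch)) → Vec Bool (length (Ztil m Δ ch)) → V m Δ → ℕ
targetExponents m Δ ch S T v = expo v (map inj₁ (select (Ytil m Δ ch) S) ++ map inj₂ (select (Ztil m Δ ch) T))

module Entries {c ℓ} (F : Field c ℓ) (m Δ : ℕ) (ch : Choice m Δ) where
  open Field F using (_≈_; 0#; 1#; +-identityˡ; +-identityʳ; +-cong) renaming (refl to ≈-refl; trans to ≈-trans)
  open LinAlg F using (sumList)

  -- The summand of relMatrix is local to its definition; unification gives it a name here.
  summands : ∀ S T → ∃ λ G → relMatrix F m Δ ch S T ≡ sumList (map G (pathMons m Δ))
  summands S T = _ , refl

  summand-≡ : ∀ S T p → proj₁ (summands S T) p ≡ (if yields (rho m Δ ch) (targetExponents m Δ ch S T) p then 1# else 0#)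
  summand-≡ S T p with restrictMon (rho m Δ ch) p
  ... | nothing = refl
  ... | just _  = refl

  sumList-if : {A : Set} (b : A → Bool) (xs : List A) →
    (countᵇ b xs ≡ 0 → sumList (map (λ x → if b x then 1# else 0#) xs) ≈ 0#) ×
    (countᵇ b xs ≡ 1 → sumList (map (λ x → if b x then 1# else 0#) xs) ≈ 1#)
  sumList-if b [] = (λ _ → ≈-refl) , λ ()
  sumList-if b (x ∷ xs) with b x
  ... | true  = (λ ()) , λ e → ≈-trans (+-cong ≈-refl (proj₁ (sumList-if b xs) (ℕₚ.suc-injective e))) (+-identityʳ 1#)
  ... | false = (λ e → ≈-trans (+-identityˡ _) (proj₁ (sumList-if b xs) e)) ,
                (λ e → ≈-trans (+-identityˡ _) (proj₂ (sumList-if b xs) e))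

  relMatrix-≡ : ∀ S T → relMatrix F m Δ ch S T ≡
    sumList (map (λ p → if yields (rho m Δ ch) (targetExponents m Δ ch S T) p then 1# else 0#) (pathMons m Δ))
  relMatrix-≡ S T = trans (proj₂ (summands S T)) (cong sumList (map-cong (summand-≡ S T) (pathMons m Δ)))

  entry≈0 : ∀ S T → coeff m Δ ch (targetExponents m Δ ch S T) ≡ 0 → relMatrix F m Δ ch S T ≈ 0#
  entry≈0 S T e rewrite relMatrix-≡ S T = proj₁ (sumList-if _ (pathMons m Δ)) e

  entry≈1 : ∀ S T → coeff m Δ ch (targetExponents m Δ ch S T) ≡ 1 → relMatrix F m Δ ch S T ≈ 1#
  entry≈1 S T e rewrite relMatrix-≡ S T = proj₂ (sumList-if _ (pathMons m Δ)) e

module Diagonal (m Δ : ℕ) (ch : Choice (suc m) Δ) where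
  open Selection (_≟Y_ {suc m} {Δ})

  Ỹ : List (YV (suc m) Δ)
  Ỹ = Ytil (suc m) Δ ch

  column : Vec Bool (length Ỹ) → Vec Bool (length (Ztil (suc m) Δ ch))
  column S = subst (λ l → Vec Bool (length l)) (Ytil≡Ztil m Δ ch) (complement S)

  select-column : ∀ S → select (Ztil (suc m) Δ ch) (column S) ≡ select Ỹ (complement S)
  select-column S = select-subst (Ytil≡Ztil m Δ ch) (complement S)
    where
    select-subst : ∀ {L L′ : List (YV (suc m) Δ)} (e : L ≡ L′) (v : Vec Bool (length L)) →
      select L′ (subst (λ l → Vec Bool (length l)) e v) ≡ select L v
    select-subst refl v = refl

  countᵇ-false : ∀ (ys : List (YV (suc m) Δ)) → countᵇ (λ _ → false) ys ≡ 0
  countᵇ-false ys = cong length (filterᵇ-none {xs = ys} (All.universal (λ _ → refl) ys))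

  expo-inj₁ : ∀ (ys zs : List (YV (suc m) Δ)) y → expo (inj₁ y) (map inj₁ ys ++ map inj₂ zs) ≡ count y ys
  expo-inj₁ ys zs y = begin
    expo (inj₁ y) (map inj₁ ys ++ map inj₂ zs)                 ≡⟨ countᵇ-++ _ (map inj₁ ys) (map inj₂ zs) ⟩
    expo (inj₁ y) (map inj₁ ys) + expo (inj₁ y) (map inj₂ zs)  ≡⟨ cong₂ _+_ (countᵇ-map _ inj₁ ys) (countᵇ-map _ inj₂ zs) ⟩
    count y ys + countᵇ (λ _ → false) zs                        ≡⟨ cong (count y ys +_) (countᵇ-false zs) ⟩
    count y ys + 0                                              ≡⟨ ℕₚ.+-identityʳ _ ⟩
    count y ys                                                  ∎
    where open ≡-Reasoning

  expo-inj₂ : ∀ (ys zs : List (YV (suc m) Δ)) y → expo (inj₂ y) (map inj₁ ys ++ map inj₂ zs) ≡ count y zs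
  expo-inj₂ ys zs y = begin
    expo (inj₂ y) (map inj₁ ys ++ map inj₂ zs)                 ≡⟨ countᵇ-++ _ (map inj₁ ys) (map inj₂ zs) ⟩
    expo (inj₂ y) (map inj₁ ys) + expo (inj₂ y) (map inj₂ zs)  ≡⟨ cong₂ _+_ (countᵇ-map _ inj₁ ys) (countᵇ-map _ inj₂ zs) ⟩
    countᵇ (λ _ → false) ys + count y zs                        ≡⟨ cong (_+ count y zs) (countᵇ-false ys) ⟩
    count y zs                                                  ∎
    where open ≡-Reasoning

  module _ (S′ S : Vec Bool (length Ỹ)) where

    w : V (suc m) Δ → ℕ
    w = targetExponents (suc m) Δ ch S′ (column S)

    w-y : ∀ y → w (inj₁ y) ≡ count y (select Ỹ S′)
    w-y y = expo-inj₁ (select Ỹ S′) (select (Ztil (suc m) Δ ch) (column S)) y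

    w-z : ∀ y → w (inj₂ y) ≡ count y (select Ỹ (complement S))
    w-z y = trans (expo-inj₂ (select Ỹ S′) (select (Ztil (suc m) Δ ch) (column S)) y)
                  (cong (count y) (select-column S))

    transversal⇒≡ : IsTransversal (suc m) Δ ch w → S′ ≡ S
    transversal⇒≡ tr = once⇒≡ Ỹ S′ S (Ytil-unique (suc m) Δ ch) λ {y} y∈ →
      trans (sym (cong₂ _+_ (w-y y) (w-z y))) (proj₁ (tr y) (∈Ytil⇒inImage (suc m) Δ ch y∈))

  transversal-diagonal : ∀ S → IsTransversal (suc m) Δ ch (w S S)
  transversal-diagonal S y =
    (λ img → trans (cong₂ _+_ (w-y S S y) (w-z S S y))
                   (once-complement Ỹ S y (Ytil-unique (suc m) Δ ch) (inImage⇒∈Ytil (suc m) Δ ch img))) ,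
    (λ ∉ → trans (w-y S S y) (select-∉ Ỹ S y (∉ ∘ ∈Ytil⇒inImage (suc m) Δ ch)) ,
           trans (w-z S S y) (select-∉ Ỹ (complement S) y (∉ ∘ ∈Ytil⇒inImage (suc m) Δ ch)))

lemma3p3 : ∀ {c ℓ} (F : Field c ℓ) (m : ℕ) → 1 ≤ m → (Δ : ℕ) → (ch : Choice m Δ) →
    Σ ℕ (λ r → LinAlg.HasRank F (relMatrix F m Δ ch) r ×
      r * r ≡ 2 ^ (length (Ytil m Δ ch) + length (Ztil m Δ ch)))
lemma3p3 F (suc m) (s≤s z≤n) Δ ch =
  2 ^ k , Rank.hasRank-unitColumns F (vecBool↔ k) (relMatrix F (suc m) Δ ch) column diagonal≈1 offDiagonal≈0 , rank²
  where
  open Diagonal m Δ ch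
  open Entries F (suc m) Δ ch using (entry≈0; entry≈1)
  k : ℕ
  k = length Ỹ
  diagonal≈1 : ∀ S → Field._≈_ F (relMatrix F (suc m) Δ ch S (column S)) (Field.1# F)
  diagonal≈1 S = entry≈1 S (column S) (Indicator-⇒≡1 (coeff-indicator m Δ ch (w S S)) (transversal-diagonal S))
  offDiagonal≈0 : ∀ S′ S → ¬ S′ ≡ S → Field._≈_ F (relMatrix F (suc m) Δ ch S′ (column S)) (Field.0# F)
  offDiagonal≈0 S′ S S′≢S =
    entry≈0 S′ (column S) (Indicator-¬⇒≡0 (coeff-indicator m Δ ch (w S′ S)) (S′≢S ∘ transversal⇒≡ S′ S))
  rank² : 2 ^ k * 2 ^ k ≡ 2 ^ (k + length (Ztil (suc m) Δ ch))
  rank² = trans (sym (^-distribˡ-+-* 2 k k)) (cong (λ l → 2 ^ (k + length l)) (Ytil≡Ztil m Δ ch))
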